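{- Let $G$ be a graph. (1) $G$ is $\mathcal{P}$-unique if and only if $G\,\dot\cup\, K_1$ is $\mathcal{P}$-unique. (2) $G$ is $\mathcal{P}$-unique if and only if $G\,\dot\cup\, K_2$ is $\mathcal{P}$-unique. (3) For every integer $k\ge 3$, $G\,\dot\cup\, K_k$ is not $\mathcal{P}$-unique.
   Context: Graphs are finite and simple with nonempty vertex set; $\dot\cup$ denotes disjoint union. For $S\subseteq V(G)$, $S$ is a power dominating set if, after coloring $S$, coloring every neighbor of a vertex of $S$, and then repeatedly applying the forcing rule (a colored vertex with exactly one uncolored neighbor colors that neighbor) until no changes occur, all vertices are colored. $\mathcal{P}(G;x)=\sum_{i=1}^{|V(G)|}p(G;i)x^i$, where $p(G;i)$ is the number of power dominating sets of size $i$. A graph $G$ is $\mathcal{P}$-unique if every graph $H$ with $\mathcal{P}(H;x)=\mathcal{P}(G;x)$ is isomorphic to $G$. -}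

module Defs where

open import Data.Nat using (ℕ; zero; suc; _+_; _≤_; _≡ᵇ_; z≤n; s≤s)
open import Data.Bool using (Bool; true; false; _∧_; _∨_; not; if_then_else_)
open import Data.Fin using (Fin; zero; suc; _≟_; splitAt)
open import Data.Sum using (inj₁; inj₂)
open import Data.Vec using (Vec; []; _∷_; lookup)
open import Data.List using (List; []; _∷_; _++_; map; filter; length)
open import Function.Bundles using (_↔_; Inverse)
open import Relation.Binary.PropositionalEquality using (_≡_)
open import Relation.Nullary.Decidable using (⌊_⌋)
import Data.Nat as ℕ
import Data.Bool as B
open import Data.Product using (Σ; _,_)

record Graph : Set where
  field
    n        : ℕ
    nonempty : 1 ≤ n
    adj      : Fin n → Fin n → Bool
    sym      : ∀ u v → adj u v ≡ adj v u
    irrefl   : ∀ v → adj v v ≡ false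
open Graph public

anyFin : ∀ {n} → (Fin n → Bool) → Bool
anyFin {zero}  f = false
anyFin {suc n} f = f zero ∨ anyFin (λ i → f (suc i))

allFin : ∀ {n} → (Fin n → Bool) → Bool
allFin {zero}  f = true
allFin {suc n} f = f zero ∧ allFin (λ i → f (suc i))

countFin : ∀ {n} → (Fin n → Bool) → ℕ
countFin {zero}  f = 0
countFin {suc n} f = (if f zero then 1 else 0) + countFin (λ i → f (suc i))

module _ {n : ℕ} (adj : Fin n → Fin n → Bool) where

  domStep : (Fin n → Bool) → (Fin n → Bool)
  domStep S v = S v ∨ anyFin (λ u → S u ∧ adj u v)

  uncolouredNbrs : (Fin n → Bool) → Fin n → ℕ
  uncolouredNbrs C u = countFin (λ w → adj u w ∧ not (C w))

  forceStep : (Fin n → Bool) → (Fin n → Bool)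
  forceStep C v = C v ∨ anyFin (λ u → C u ∧ adj u v ∧ not (C v) ∧ (uncolouredNbrs C u ≡ᵇ 1))

  iter : ℕ → (Fin n → Bool) → (Fin n → Bool)
  iter zero    C = C
  iter (suc k) C = iter k (forceStep C)

  -- final coloured set: n rounds of forcing always reach the fixed point
  -- (each non-stable round colours at least one new vertex)
  observed : (Fin n → Bool) → (Fin n → Bool)
  observed S = iter n (domStep S)

  isPowerDominatingᵇ : (Fin n → Bool) → Bool
  isPowerDominatingᵇ S = allFin (observed S)

subsets : (n : ℕ) → List (Vec Bool n)
subsets zero    = [] ∷ []
subsets (suc n) = map (true ∷_) (subsets n) ++ map (false ∷_) (subsets n)

card : ∀ {n} → Vec Bool n → ℕ
card []           = 0
card (true ∷ s)  = suc (card s)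
card (false ∷ s) = card s

p : Graph → ℕ → ℕ
p G i = length (filter (λ S → card S ℕ.≟ i)
  (filter (λ S → isPowerDominatingᵇ (adj G) (lookup S) B.≟ true) (subsets (n G))))

-- equality of power domination polynomials (coefficientwise; p(G;0) = 0 always)
SamePolynomial : Graph → Graph → Set
SamePolynomial H G = ∀ i → p H i ≡ p G i

_≅_ : Graph → Graph → Set
H ≅ G = Σ (Fin (n H) ↔ Fin (n G)) λ f →
  ∀ u v → adj G (Inverse.to f u) (Inverse.to f v) ≡ adj H u v

PUnique : Graph → Set
PUnique G = ∀ (H : Graph) → SamePolynomial H G → H ≅ G

private
  ≤-+ : ∀ {a} b → 1 ≤ a → 1 ≤ a + b
  ≤-+ b (s≤s z≤n) = s≤s z≤n

unionAdj : ∀ {a b} → (Fin a → Fin a → Bool) → (Fin b → Fin b → Bool) → Fin (a + b) → Fin (a + b) → Bool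
unionAdj {a} A B u v with splitAt a u | splitAt a v
... | inj₁ x | inj₁ y = A x y
... | inj₂ x | inj₂ y = B x y
... | inj₁ _ | inj₂ _ = false
... | inj₂ _ | inj₁ _ = false

unionSym : ∀ {a b} (A : Fin a → Fin a → Bool) (B : Fin b → Fin b → Bool) →
  (∀ u v → A u v ≡ A v u) → (∀ u v → B u v ≡ B v u) → ∀ u v → unionAdj A B u v ≡ unionAdj A B v u
unionSym {a} A B sA sB u v with splitAt a u | splitAt a v
... | inj₁ x | inj₁ y = sA x y
... | inj₂ x | inj₂ y = sB x y
... | inj₁ _ | inj₂ _ = Relation.Binary.PropositionalEquality.refl
... | inj₂ _ | inj₁ _ = Relation.Binary.PropositionalEquality.refl

unionIrr : ∀ {a b} (A : Fin a → Fin a → Bool) (B : Fin b → Fin b → Bool) →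
  (∀ v → A v v ≡ false) → (∀ v → B v v ≡ false) → ∀ v → unionAdj A B v v ≡ false
unionIrr {a} A B iA iB v with splitAt a v
... | inj₁ x = iA x
... | inj₂ x = iB x

_⊕_ : Graph → Graph → Graph
G ⊕ H = record
  { n = n G + n H
  ; nonempty = ≤-+ (n H) (nonempty G)
  ; adj = unionAdj (adj G) (adj H)
  ; sym = unionSym (adj G) (adj H) (sym G) (sym H)
  ; irrefl = unionIrr (adj G) (adj H) (irrefl G) (irrefl H)
  }

kAdj : ∀ {k} → Fin k → Fin k → Bool
kAdj u v = not ⌊ u ≟ v ⌋

K : (k : ℕ) → 1 ≤ k → Graph
K k h = record
  { n = k ; nonempty = h ; adj = kAdj
  ; sym = λ u v → kSym u v
  ; irrefl = λ v → kIrr v }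
  where
  open import Relation.Binary.PropositionalEquality using (refl; cong)
  open import Relation.Nullary using (yes; no)
  kIrr : ∀ v → kAdj {k} v v ≡ false
  kIrr v with v ≟ v
  ... | yes _ = refl
  ... | no ¬p = Data.Empty.⊥-elim (¬p refl)
    where import Data.Empty
  kSym : ∀ u v → kAdj {k} u v ≡ kAdj v u
  kSym u v with u ≟ v | v ≟ u
  ... | yes _ | yes _ = refl
  ... | no _ | no _ = refl
  ... | yes e | no ¬e = Data.Empty.⊥-elim (¬e (Relation.Binary.PropositionalEquality.sym e))
    where import Data.Empty
  ... | no ¬e | yes e = Data.Empty.⊥-elim (¬e (Relation.Binary.PropositionalEquality.sym e))
    where import Data.Empty

module Submission where

open import Defs renaming (sym to adj-sym)
open import Data.Nat using (ℕ; zero; suc; _+_; _∸_; _≤_; _<_; _≡ᵇ_; z≤n; s≤s)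
import Data.Nat as ℕ
open import Data.Nat.Properties hiding (_≟_)
open import Data.Bool using (Bool; true; false; _∧_; _∨_; not; if_then_else_)
import Data.Bool as B
open import Data.Bool.Properties using (∧-zeroʳ; ∧-identityʳ; ∧-assoc; ∨-zeroʳ; ∨-identityʳ; ∨-assoc)
open import Data.Fin using (Fin; zero; suc; _≟_; _↑ˡ_; _↑ʳ_; splitAt; punchIn; punchOut)
open import Data.Fin.Properties as Finₚ
  using (splitAt-↑ˡ; splitAt-↑ʳ; splitAt⁻¹-↑ˡ; splitAt⁻¹-↑ʳ; +↔⊎; punchIn-punchOut; punchInᵢ≢i; punchIn-injective)
open import Data.Fin.Permutation as Perm using (Permutation; _⟨$⟩ʳ_; _⟨$⟩ˡ_; inverseʳ; inverseˡ; _∘ₚ_; remove; punchIn-permute; transpose)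
import Data.Fin.Permutation.Components as PC
open import Data.Vec using (Vec; []; _∷_; lookup; tabulate; insertAt; _++_)
open import Data.Vec.Properties using (tabulate-cong; lookup∘tabulate; insertAt-lookup; insertAt-punchIn; lookup-++ˡ; lookup-++ʳ)
open import Data.List using (List; []; _∷_; map; filter; length) renaming (_++_ to _++ₗ_)
open import Data.Product using (Σ; ∃; _×_; _,_; proj₁; proj₂)
open import Data.Sum using (_⊎_; inj₁; inj₂; [_,_]′; swap)
open import Data.Sum.Algebra using (⊎-comm)
open import Data.Sum.Function.Propositional using (_⊎-↔_)
open import Data.Empty using (⊥-elim)
open import Data.Unit using (⊤; tt)
open import Function using (_∘_)
open import Function.Bundles using (_⇔_; mk⇔; _↔_; Inverse)
open import Function.Properties.Inverse using (↔-trans; ↔-sym)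
open import Relation.Nullary using (¬_; Dec; does; yes; no; contradiction)
open import Relation.Binary.Definitions using (tri<; tri≈; tri>)
open import Relation.Nullary.Decidable using (dec-true; dec-false)
open import Relation.Binary.PropositionalEquality
open import Algebra.Properties.CommutativeSemigroup +-commutativeSemigroup
  using () renaming (interchange to +-interchange)
open import Algebra.Properties.CommutativeMonoid.Sum +-0-commutativeMonoid
  using (sum; sum-cong-≗; sum-permute; ∑-distrib-+; sum-replicate-zero)

χ : Bool → ℕ
χ b = if b then 1 else 0

bool-ext : ∀ {a b : Bool} → (a ≡ true → b ≡ true) → (b ≡ true → a ≡ true) → a ≡ b
bool-ext {true}  {true}  _ _ = refl
bool-ext {false} {false} _ _ = refl
bool-ext {true}  {false} f _ = sym (f refl)
bool-ext {false} {true}  _ g = g refl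

-- Equality of vertices, decided without abstracting over the decision.
≡-or-≢ : ∀ {k} (x y : Fin k) → x ≡ y ⊎ x ≢ y
≡-or-≢ x y with x ≟ y
... | yes x≡y = inj₁ x≡y
... | no  x≢y = inj₂ x≢y

-- Case analysis on a Boolean, likewise without abstracting over it.
true-or-false : ∀ b → b ≡ true ⊎ b ≡ false
true-or-false true  = inj₁ refl
true-or-false false = inj₂ refl

∧-true : ∀ {a b} → a ∧ b ≡ true → (a ≡ true) × (b ≡ true)
∧-true {true} {true} _ = refl , refl

anyFin-intro : ∀ {k} (f : Fin k → Bool) i → f i ≡ true → anyFin f ≡ true
anyFin-intro f zero    e = cong (_∨ anyFin (f ∘ suc)) e
anyFin-intro f (suc i) e = trans (cong (f zero ∨_) (anyFin-intro (f ∘ suc) i e)) (∨-zeroʳ (f zero))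

anyFin-elim : ∀ {k} (f : Fin k → Bool) → anyFin f ≡ true → ∃ λ i → f i ≡ true
anyFin-elim {zero}  f ()
anyFin-elim {suc k} f h with f zero in e
... | true  = zero , e
... | false = let i , fi = anyFin-elim (f ∘ suc) h in suc i , fi

anyFin-none : ∀ {k} (f : Fin k → Bool) → (∀ i → f i ≡ false) → anyFin f ≡ false
anyFin-none {zero}  f h = refl
anyFin-none {suc k} f h rewrite h zero = anyFin-none (f ∘ suc) (h ∘ suc)

anyFin-none⁻ : ∀ {k} (f : Fin k → Bool) → anyFin f ≡ false → ∀ i → f i ≡ false
anyFin-none⁻ f h i with f i in e
... | false = refl
... | true  = trans (sym (anyFin-intro f i e)) h

allFin-intro : ∀ {k} (f : Fin k → Bool) → (∀ i → f i ≡ true) → allFin f ≡ true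
allFin-intro {zero}  f h = refl
allFin-intro {suc k} f h rewrite h zero = allFin-intro (f ∘ suc) (h ∘ suc)

allFin-elim : ∀ {k} (f : Fin k → Bool) → allFin f ≡ true → ∀ i → f i ≡ true
allFin-elim f h zero    = proj₁ (∧-true h)
allFin-elim f h (suc i) = allFin-elim (f ∘ suc) (proj₂ (∧-true h)) i

allFin-refute : ∀ {k} (f : Fin k → Bool) i → f i ≡ false → allFin f ≡ false
allFin-refute f i e with allFin f in h
... | false = refl
... | true  = trans (sym (allFin-elim f h i)) e

allFin-refute⁻ : ∀ {k} (f : Fin k → Bool) → allFin f ≡ false → ∃ λ i → f i ≡ false
allFin-refute⁻ {zero}  f ()
allFin-refute⁻ {suc k} f h with f zero in e
... | false = zero , e
... | true  = let i , fi = allFin-refute⁻ (f ∘ suc) h in suc i , fi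

anyFin-cong : ∀ {k} {f g : Fin k → Bool} → f ≗ g → anyFin f ≡ anyFin g
anyFin-cong {zero}  e = refl
anyFin-cong {suc k} e = cong₂ _∨_ (e zero) (anyFin-cong (e ∘ suc))

allFin-cong : ∀ {k} {f g : Fin k → Bool} → f ≗ g → allFin f ≡ allFin g
allFin-cong {zero}  e = refl
allFin-cong {suc k} e = cong₂ _∧_ (e zero) (allFin-cong (e ∘ suc))

anyFin-permute : ∀ {k m} (π : Permutation k m) (f : Fin m → Bool) → anyFin f ≡ anyFin (f ∘ (π ⟨$⟩ʳ_))
anyFin-permute π f = bool-ext
  (λ h → let i , fi = anyFin-elim f h in anyFin-intro _ (π ⟨$⟩ˡ i) (trans (cong f (inverseʳ π)) fi))
  (λ h → let i , fi = anyFin-elim (f ∘ (π ⟨$⟩ʳ_)) h in anyFin-intro f _ fi)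

allFin-permute : ∀ {k m} (π : Permutation k m) (f : Fin m → Bool) → allFin f ≡ allFin (f ∘ (π ⟨$⟩ʳ_))
allFin-permute π f = bool-ext
  (λ h → allFin-intro _ (λ i → allFin-elim f h (π ⟨$⟩ʳ i)))
  (λ h → allFin-intro f (λ i → trans (cong f (sym (inverseʳ π))) (allFin-elim _ h (π ⟨$⟩ˡ i))))

anyFin-split : ∀ a {b} (f : Fin (a + b) → Bool) → anyFin f ≡ anyFin (λ i → f (i ↑ˡ b)) ∨ anyFin (λ j → f (a ↑ʳ j))
anyFin-split zero    f = refl
anyFin-split (suc a) f = trans (cong (f zero ∨_) (anyFin-split a (f ∘ suc))) (sym (∨-assoc (f zero) _ _))

allFin-split : ∀ a {b} (f : Fin (a + b) → Bool) → allFin f ≡ allFin (λ i → f (i ↑ˡ b)) ∧ allFin (λ j → f (a ↑ʳ j))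
allFin-split zero    f = refl
allFin-split (suc a) f = trans (cong (f zero ∧_) (allFin-split a (f ∘ suc))) (sym (∧-assoc (f zero) _ _))

-- countFin is the sum of the indicators, so it inherits the properties of sums.
countFin-sum : ∀ {k} (f : Fin k → Bool) → countFin f ≡ sum (χ ∘ f)
countFin-sum {zero}  f = refl
countFin-sum {suc k} f = cong (χ (f zero) +_) (countFin-sum (f ∘ suc))

countFin-cong : ∀ {k} {f g : Fin k → Bool} → f ≗ g → countFin f ≡ countFin g
countFin-cong {f = f} {g} e = begin
  countFin f    ≡⟨ countFin-sum f ⟩
  sum (χ ∘ f)   ≡⟨ sum-cong-≗ (cong χ ∘ e) ⟩
  sum (χ ∘ g)   ≡⟨ countFin-sum g ⟨
  countFin g    ∎
  where open ≡-Reasoning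

countFin-permute : ∀ {k m} (π : Permutation k m) (f : Fin m → Bool) → countFin f ≡ countFin (f ∘ (π ⟨$⟩ʳ_))
countFin-permute π f = begin
  countFin f                     ≡⟨ countFin-sum f ⟩
  sum (χ ∘ f)                    ≡⟨ sum-permute (χ ∘ f) π ⟩
  sum (χ ∘ f ∘ (π ⟨$⟩ʳ_))        ≡⟨ countFin-sum (f ∘ (π ⟨$⟩ʳ_)) ⟨
  countFin (f ∘ (π ⟨$⟩ʳ_))       ∎
  where open ≡-Reasoning

countFin-split : ∀ a {b} (f : Fin (a + b) → Bool) → countFin f ≡ countFin (λ i → f (i ↑ˡ b)) + countFin (λ j → f (a ↑ʳ j))
countFin-split zero    f = refl
countFin-split (suc a) f = trans (cong (χ (f zero) +_) (countFin-split a (f ∘ suc))) (sym (+-assoc (χ (f zero)) _ _))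

countFin-none : ∀ {k} (f : Fin k → Bool) → (∀ i → f i ≡ false) → countFin f ≡ 0
countFin-none {zero}  f h = refl
countFin-none {suc k} f h rewrite h zero = countFin-none (f ∘ suc) (h ∘ suc)

countFin-all : ∀ {k} (f : Fin k → Bool) → (∀ i → f i ≡ true) → countFin f ≡ k
countFin-all {zero}  f h = refl
countFin-all {suc k} f h rewrite h zero = cong suc (countFin-all (f ∘ suc) (h ∘ suc))

countFin-unique : ∀ {k} (f : Fin k → Bool) x → f x ≡ true → (∀ z → f z ≡ true → z ≡ x) → countFin f ≡ 1
countFin-unique f zero e h rewrite e = cong suc (countFin-none (f ∘ suc) others)
  where
  others : ∀ z → f (suc z) ≡ false
  others z with f (suc z) in q
  ... | false = refl
  ... | true  with () ← h (suc z) q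
countFin-unique {suc k} f (suc x) e h with f zero in q
... | true  with () ← h zero q
... | false = countFin-unique (f ∘ suc) x e (λ z fz → Finₚ.suc-injective (h (suc z) fz))

countFin-mono : ∀ {k} (f g : Fin k → Bool) → (∀ i → f i ≡ true → g i ≡ true) → countFin f ≤ countFin g
countFin-mono {zero}  f g h = z≤n
countFin-mono {suc k} f g h with f zero in e₁ | g zero in e₂
... | true  | true  = s≤s (countFin-mono _ _ (h ∘ suc))
... | false | true  = m≤n⇒m≤1+n (countFin-mono _ _ (h ∘ suc))
... | false | false = countFin-mono _ _ (h ∘ suc)
... | true  | false with () ← trans (sym e₂) (h zero e₁)

countFin-grow : ∀ {k} (f g : Fin k → Bool) → (∀ i → f i ≡ true → g i ≡ true) →
  ∀ v → f v ≡ false → g v ≡ true → countFin f < countFin g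
countFin-grow f g h zero e₁ e₂ rewrite e₁ | e₂ = s≤s (countFin-mono _ _ (h ∘ suc))
countFin-grow {suc k} f g h (suc v) e₁ e₂ with f zero in a₁ | g zero in a₂
... | true  | true  = s≤s (countFin-grow _ _ (h ∘ suc) v e₁ e₂)
... | false | true  = m≤n⇒m≤1+n (countFin-grow _ _ (h ∘ suc) v e₁ e₂)
... | false | false = countFin-grow _ _ (h ∘ suc) v e₁ e₂
... | true  | false with () ← trans (sym a₂) (h zero a₁)

countFin-< : ∀ {k} (f : Fin k → Bool) v → f v ≡ false → countFin f < k
countFin-< f v e = ≤-trans (countFin-grow f (λ _ → true) (λ _ _ → refl) v e refl) (≤-reflexive (countFin-all _ (λ _ → refl)))

module Process {N : ℕ} (A : Fin N → Fin N → Bool) where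

  domStep-cong : ∀ {S T} → S ≗ T → domStep A S ≗ domStep A T
  domStep-cong e v = cong₂ _∨_ (e v) (anyFin-cong (λ u → cong (_∧ A u v) (e u)))

  forceStep-cong : ∀ {C D} → C ≗ D → forceStep A C ≗ forceStep A D
  forceStep-cong {C} {D} e v = cong₂ _∨_ (e v) (anyFin-cong λ u →
    cong₃ (λ a b k → a ∧ A u v ∧ not b ∧ (k ≡ᵇ 1)) (e u) (e v) (uncoloured-cong u))
    where
    cong₃ : ∀ {A B C D : Set} (f : A → B → C → D) {a a' b b' c c'} → a ≡ a' → b ≡ b' → c ≡ c' → f a b c ≡ f a' b' c'
    cong₃ f refl refl refl = refl
    uncoloured-cong : ∀ u → uncolouredNbrs A C u ≡ uncolouredNbrs A D u
    uncoloured-cong u = countFin-cong (λ w → cong (λ b → A u w ∧ not b) (e w))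

  iter-cong : ∀ k {C D} → C ≗ D → iter A k C ≗ iter A k D
  iter-cong zero    e = e
  iter-cong (suc k) e = iter-cong k (forceStep-cong e)

  iter-suc : ∀ k C → iter A (suc k) C ≗ forceStep A (iter A k C)
  iter-suc zero    C v = refl
  iter-suc (suc k) C v = iter-suc k (forceStep A C) v

  forceStep-inflationary : ∀ C v → C v ≡ true → forceStep A C v ≡ true
  forceStep-inflationary C v e rewrite e = refl

  iter-inflationary : ∀ k C v → C v ≡ true → iter A k C v ≡ true
  iter-inflationary zero    C v e = e
  iter-inflationary (suc k) C v e = iter-inflationary k (forceStep A C) v (forceStep-inflationary C v e)

  -- Stabilisation: a round that changes nothing is a fixed point, and each
  -- round that changes something colours a new vertex, so after N rounds the
  -- process has stopped.

  Fixed : (Fin N → Bool) → Set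
  Fixed C = forceStep A C ≗ C

  fixed-iter : ∀ k C → Fixed C → iter A k C ≗ C
  fixed-iter zero    C f v = refl
  fixed-iter (suc k) C f v = trans (iter-cong k f v) (fixed-iter k C f v)

  fixed-or-grows : ∀ C → Fixed C ⊎ countFin C < countFin (forceStep A C)
  fixed-or-grows C with anyFin (λ v → forceStep A C v ∧ not (C v)) in e
  ... | true  = let v , h = anyFin-elim _ e ; fv , ¬cv = ∧-true h in
    inj₂ (countFin-grow C (forceStep A C) (forceStep-inflationary C) v (not-true ¬cv) fv)
    where
    not-true : ∀ {b} → not b ≡ true → b ≡ false
    not-true {false} _ = refl
  ... | false = inj₁ (λ v → unchanged (C v) (forceStep A C v) (forceStep-inflationary C v) (anyFin-none⁻ _ e v))
    where
    unchanged : ∀ c a → (c ≡ true → a ≡ true) → a ∧ not c ≡ false → a ≡ c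
    unchanged true  _     h _ = h refl
    unchanged false false _ _ = refl

  fixed-next : ∀ j C → Fixed (iter A j C) → Fixed (iter A (suc j) C)
  fixed-next j C f v = begin
    forceStep A (iter A (suc j) C) v      ≡⟨ forceStep-cong (iter-suc j C) v ⟩
    forceStep A (forceStep A (iter A j C)) v ≡⟨ forceStep-cong f v ⟩
    forceStep A (iter A j C) v            ≡⟨ iter-suc j C v ⟨
    iter A (suc j) C v                    ∎
    where open ≡-Reasoning

  fixed-or-large : ∀ j C → Fixed (iter A j C) ⊎ j ≤ countFin (iter A j C)
  fixed-or-large zero    C = inj₂ z≤n
  fixed-or-large (suc j) C with fixed-or-large j C
  ... | inj₁ f = inj₁ (fixed-next j C f)
  ... | inj₂ h with fixed-or-grows (iter A j C)
  ...   | inj₁ f = inj₁ (fixed-next j C f)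
  ...   | inj₂ g = inj₂ (≤-trans (s≤s h) (≤-trans g (≤-reflexive (sym (countFin-cong (iter-suc j C))))))

  full-fixed : ∀ C → N ≤ countFin C → Fixed C
  full-fixed C h v with C v in e
  ... | true  = refl
  ... | false with () ← <-irrefl refl (<-≤-trans (countFin-< C v e) h)

  iter-N-fixed : ∀ C → Fixed (iter A N C)
  iter-N-fixed C with fixed-or-large N C
  ... | inj₁ f = f
  ... | inj₂ h = full-fixed _ h

  iter-stable : ∀ k C → N ≤ k → iter A k C ≗ iter A N C
  iter-stable k C h v = begin
    iter A k C v                       ≡⟨ cong (λ j → iter A j C v) (sym (m+[n∸m]≡n h)) ⟩
    iter A (N + (k ∸ N)) C v           ≡⟨ iter-+ N (k ∸ N) C v ⟩
    iter A (k ∸ N) (iter A N C) v      ≡⟨ fixed-iter (k ∸ N) _ (iter-N-fixed C) v ⟩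
    iter A N C v                       ∎
    where
    open ≡-Reasoning
    iter-+ : ∀ a b C → iter A (a + b) C ≗ iter A b (iter A a C)
    iter-+ zero    b C v = refl
    iter-+ (suc a) b C v = iter-+ a b (forceStep A C) v

  isPD-cong : ∀ {S T} → S ≗ T → isPowerDominatingᵇ A S ≡ isPowerDominatingᵇ A T
  isPD-cong e = allFin-cong (iter-cong N (domStep-cong e))

sumSubsets : (k : ℕ) → (Vec Bool k → ℕ) → ℕ
sumSubsets zero    f = f []
sumSubsets (suc k) f = sumSubsets k (f ∘ (true ∷_)) + sumSubsets k (f ∘ (false ∷_))

sumSubsets-cong : ∀ k {f g : Vec Bool k → ℕ} → f ≗ g → sumSubsets k f ≡ sumSubsets k g
sumSubsets-cong zero    e = e []
sumSubsets-cong (suc k) e = cong₂ _+_ (sumSubsets-cong k (e ∘ (true ∷_))) (sumSubsets-cong k (e ∘ (false ∷_)))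

sumSubsets-zero : ∀ k {f : Vec Bool k → ℕ} → (∀ S → f S ≡ 0) → sumSubsets k f ≡ 0
sumSubsets-zero zero    e = e []
sumSubsets-zero (suc k) e = cong₂ _+_ (sumSubsets-zero k (e ∘ (true ∷_))) (sumSubsets-zero k (e ∘ (false ∷_)))

sumSubsets-++ : ∀ a b (f : Vec Bool (a + b) → ℕ) → sumSubsets (a + b) f ≡ sumSubsets a (λ s → sumSubsets b (λ t → f (s ++ t)))
sumSubsets-++ zero    b f = refl
sumSubsets-++ (suc a) b f = cong₂ _+_ (sumSubsets-++ a b (f ∘ (true ∷_))) (sumSubsets-++ a b (f ∘ (false ∷_)))

sumSubsets-insert : ∀ k (i : Fin (suc k)) (f : Vec Bool (suc k) → ℕ) →
  sumSubsets (suc k) f ≡ sumSubsets k (λ s → f (insertAt s i true)) + sumSubsets k (λ s → f (insertAt s i false))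
sumSubsets-insert k       zero    f = refl
sumSubsets-insert (suc k) (suc i) f = trans
  (cong₂ _+_ (sumSubsets-insert k i (f ∘ (true ∷_))) (sumSubsets-insert k i (f ∘ (false ∷_))))
  (+-interchange (block true true) (block true false) (block false true) (block false false))
  where
  block : Bool → Bool → ℕ
  block b c = sumSubsets k (λ s → f (b ∷ insertAt s i c))

relabel : ∀ {k m} → Permutation k m → Vec Bool m → Vec Bool k
relabel ρ T = tabulate (λ j → lookup T (ρ ⟨$⟩ʳ j))

relabel-insert : ∀ {k m} (ρ : Permutation (suc k) (suc m)) (s : Vec Bool m) b →
  relabel ρ (insertAt s (ρ ⟨$⟩ʳ zero) b) ≡ b ∷ relabel (remove zero ρ) s
relabel-insert ρ s b = cong₂ _∷_ (insertAt-lookup s (ρ ⟨$⟩ʳ zero) b)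
  (tabulate-cong (λ j → trans (cong (lookup (insertAt s (ρ ⟨$⟩ʳ zero) b)) (punchIn-permute ρ zero j))
     (insertAt-punchIn s (ρ ⟨$⟩ʳ zero) b (remove zero ρ ⟨$⟩ʳ j))))

sumSubsets-relabel : ∀ k m (ρ : Permutation k m) (F : Vec Bool k → ℕ) → sumSubsets k F ≡ sumSubsets m (F ∘ relabel ρ)
sumSubsets-relabel zero    zero    ρ F = refl
sumSubsets-relabel zero    (suc m) ρ F = ⊥-elim (Perm.refute (λ ()) ρ)
sumSubsets-relabel (suc k) zero    ρ F = ⊥-elim (Perm.refute (λ ()) ρ)
sumSubsets-relabel (suc k) (suc m) ρ F = sym (trans (sumSubsets-insert m (ρ ⟨$⟩ʳ zero) (F ∘ relabel ρ)) (cong₂ _+_ (part true) (part false)))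
  where
  part : ∀ b → sumSubsets m (λ s → F (relabel ρ (insertAt s (ρ ⟨$⟩ʳ zero) b))) ≡ sumSubsets k (F ∘ (b ∷_))
  part b = trans (sumSubsets-cong m (λ s → cong F (relabel-insert ρ s b))) (sym (sumSubsets-relabel k m (remove zero ρ) (F ∘ (b ∷_))))

listSum : ∀ {A : Set} → List A → (A → ℕ) → ℕ
listSum []       g = 0
listSum (x ∷ xs) g = g x + listSum xs g

listSum-subsets : ∀ k g → listSum (subsets k) g ≡ sumSubsets k g
listSum-subsets zero    g = +-identityʳ (g [])
listSum-subsets (suc k) g = begin
  listSum (map (true ∷_) (subsets k) ++ₗ map (false ∷_) (subsets k)) g   ≡⟨ listSum-++ (map (true ∷_) (subsets k)) _ ⟩
  listSum (map (true ∷_) (subsets k)) g + listSum (map (false ∷_) (subsets k)) g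
    ≡⟨ cong₂ _+_ (trans (listSum-map (true ∷_) (subsets k)) (listSum-subsets k _)) (trans (listSum-map (false ∷_) (subsets k)) (listSum-subsets k _)) ⟩
  sumSubsets (suc k) g                                                    ∎
  where
  open ≡-Reasoning
  listSum-++ : ∀ xs ys → listSum (xs ++ₗ ys) g ≡ listSum xs g + listSum ys g
  listSum-++ []       ys = refl
  listSum-++ (x ∷ xs) ys = trans (cong (g x +_) (listSum-++ xs ys)) (sym (+-assoc (g x) _ _))
  listSum-map : ∀ (h : Vec Bool k → Vec Bool (suc k)) xs → listSum (map h xs) g ≡ listSum xs (g ∘ h)
  listSum-map h []       = refl
  listSum-map h (x ∷ xs) = cong (g (h x) +_) (listSum-map h xs)

length-filter² : ∀ {A : Set} {P Q : A → Set} (P? : ∀ x → Dec (P x)) (Q? : ∀ x → Dec (Q x)) xs →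
  length (filter P? (filter Q? xs)) ≡ listSum xs (λ x → χ (does (Q? x) ∧ does (P? x)))
length-filter² P? Q? [] = refl
length-filter² P? Q? (x ∷ xs) with Q? x
... | no _  = length-filter² P? Q? xs
... | yes _ with P? x
...   | yes _ = cong suc (length-filter² P? Q? xs)
...   | no _  = length-filter² P? Q? xs

PD : (G : Graph) → Vec Bool (n G) → Bool
PD G S = isPowerDominatingᵇ (adj G) (lookup S)

p-as-sum : ∀ G i → p G i ≡ sumSubsets (n G) (λ S → χ (PD G S ∧ does (card S ℕ.≟ i)))
p-as-sum G i = begin
  p G i                                                         ≡⟨ length-filter² (λ S → card S ℕ.≟ i) (λ S → PD G S B.≟ true) (subsets (n G)) ⟩
  listSum (subsets (n G)) (λ S → χ (does (PD G S B.≟ true) ∧ does (card S ℕ.≟ i)))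
    ≡⟨ listSum-subsets (n G) _ ⟩
  sumSubsets (n G) (λ S → χ (does (PD G S B.≟ true) ∧ does (card S ℕ.≟ i)))
    ≡⟨ sumSubsets-cong (n G) (λ S → cong (λ b → χ (b ∧ does (card S ℕ.≟ i))) (does-≟-true (PD G S))) ⟩
  sumSubsets (n G) (λ S → χ (PD G S ∧ does (card S ℕ.≟ i)))      ∎
  where
  open ≡-Reasoning
  does-≟-true : ∀ b → does (b B.≟ true) ≡ b
  does-≟-true true  = refl
  does-≟-true false = refl

module Relabel {k m : ℕ} (A : Fin k → Fin k → Bool) (B : Fin m → Fin m → Bool)
  (π : Permutation k m) (pres : ∀ u v → B (π ⟨$⟩ʳ u) (π ⟨$⟩ʳ v) ≡ A u v) where

  private
    πʳ : Fin k → Fin m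
    πʳ = π ⟨$⟩ʳ_

  domStep-relabel : ∀ S v → domStep A (S ∘ πʳ) v ≡ domStep B S (πʳ v)
  domStep-relabel S v = cong (S (πʳ v) ∨_) (sym (trans (anyFin-permute π (λ w → S w ∧ B w (πʳ v)))
    (anyFin-cong (λ u → cong (S (πʳ u) ∧_) (pres u v)))))

  uncoloured-relabel : ∀ C u → uncolouredNbrs A (C ∘ πʳ) u ≡ uncolouredNbrs B C (πʳ u)
  uncoloured-relabel C u = sym (trans (countFin-permute π (λ w → B (πʳ u) w ∧ not (C w)))
    (countFin-cong (λ w → cong (λ b → b ∧ not (C (πʳ w))) (pres u w))))

  forceStep-relabel : ∀ C v → forceStep A (C ∘ πʳ) v ≡ forceStep B C (πʳ v)
  forceStep-relabel C v = cong (C (πʳ v) ∨_) (sym (trans (anyFin-permute π _)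
    (anyFin-cong (λ u → cong₂ (λ a j → C (πʳ u) ∧ a ∧ not (C (πʳ v)) ∧ (j ≡ᵇ 1)) (pres u v) (sym (uncoloured-relabel C u))))))

  iter-relabel : ∀ j C v → iter A j (C ∘ πʳ) v ≡ iter B j C (πʳ v)
  iter-relabel zero    C v = refl
  iter-relabel (suc j) C v = trans (Process.iter-cong A j (forceStep-relabel C) v) (iter-relabel j (forceStep B C) v)

  isPD-relabel : ∀ S → isPowerDominatingᵇ A (S ∘ πʳ) ≡ isPowerDominatingᵇ B S
  isPD-relabel S = begin
    allFin (iter A k (domStep A (S ∘ πʳ)))        ≡⟨ allFin-cong (λ v → trans (Process.iter-cong A k (domStep-relabel S) v) (iter-relabel k _ v)) ⟩
    allFin (iter B k (domStep B S) ∘ πʳ)          ≡⟨ allFin-permute π _ ⟨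
    allFin (iter B k (domStep B S))               ≡⟨ cong (λ j → allFin (iter B j (domStep B S))) (Perm.↔⇒≡ π) ⟩
    allFin (iter B m (domStep B S))               ∎
    where open ≡-Reasoning

card-countFin : ∀ {k} (S : Vec Bool k) → card S ≡ countFin (lookup S)
card-countFin []          = refl
card-countFin (true ∷ S)  = cong suc (card-countFin S)
card-countFin (false ∷ S) = card-countFin S

≅⇒same : ∀ H G → H ≅ G → SamePolynomial H G
≅⇒same H G (π , pres) i = begin
  p H i                                         ≡⟨ p-as-sum H i ⟩
  sumSubsets (n H) (λ T → term (PD H T) (card T)) ≡⟨ sumSubsets-cong (n H) (λ T → cong₂ term (sym (PD-relabel T)) (sym (card-relabel T))) ⟩
  sumSubsets (n H) (λ T → term (PD G (relabel π⁻¹ T)) (card (relabel π⁻¹ T)))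
                                                ≡⟨ sumSubsets-relabel (n G) (n H) π⁻¹ _ ⟨
  sumSubsets (n G) (λ S → term (PD G S) (card S)) ≡⟨ p-as-sum G i ⟨
  p G i                                         ∎
  where
  open ≡-Reasoning
  open Relabel (adj H) (adj G) π pres
  π⁻¹ = Perm.flip π
  term : Bool → ℕ → ℕ
  term b c = χ (b ∧ does (c ℕ.≟ i))
  PD-relabel : ∀ T → PD G (relabel π⁻¹ T) ≡ PD H T
  PD-relabel T = begin
    PD G (relabel π⁻¹ T)                                             ≡⟨ Process.isPD-cong (adj G) (lookup∘tabulate _) ⟩
    isPowerDominatingᵇ (adj G) (λ j → lookup T (π ⟨$⟩ˡ j))           ≡⟨ isPD-relabel (λ j → lookup T (π ⟨$⟩ˡ j)) ⟨
    isPowerDominatingᵇ (adj H) (λ u → lookup T (π ⟨$⟩ˡ (π ⟨$⟩ʳ u)))  ≡⟨ Process.isPD-cong (adj H) (λ u → cong (lookup T) (inverseˡ π)) ⟩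
    PD H T                                                           ∎
  card-relabel : ∀ T → card (relabel π⁻¹ T) ≡ card T
  card-relabel T = begin
    card (relabel π⁻¹ T)                     ≡⟨ card-countFin (relabel π⁻¹ T) ⟩
    countFin (lookup (relabel π⁻¹ T))        ≡⟨ countFin-cong (lookup∘tabulate (lookup T ∘ (π⁻¹ ⟨$⟩ʳ_))) ⟩
    countFin (lookup T ∘ (π⁻¹ ⟨$⟩ʳ_))        ≡⟨ countFin-permute π⁻¹ (lookup T) ⟨
    countFin (lookup T)                      ≡⟨ card-countFin T ⟨
    card T                                   ∎

≅-refl : ∀ G → G ≅ G
≅-refl G = Perm.id , λ u v → refl

≅-sym : ∀ {H G} → H ≅ G → G ≅ H
≅-sym {H} {G} (π , pres) = Perm.flip π , λ u v →
  trans (sym (pres (π ⟨$⟩ˡ u) (π ⟨$⟩ˡ v))) (cong₂ (adj G) (inverseʳ π) (inverseʳ π))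

≅-trans : ∀ {A B C} → A ≅ B → B ≅ C → A ≅ C
≅-trans (π , pπ) (ρ , pρ) = π ∘ₚ ρ , λ u v → trans (pρ _ _) (pπ u v)

anyFin-onLeft : ∀ a {b} (f : Fin (a + b) → Bool) → (∀ y → f (a ↑ʳ y) ≡ false) → anyFin f ≡ anyFin (λ x → f (x ↑ˡ b))
anyFin-onLeft a {b} f h = trans (anyFin-split a f) (trans (cong (anyFin (λ x → f (x ↑ˡ b)) ∨_) (anyFin-none _ h)) (∨-identityʳ _))

anyFin-onRight : ∀ a {b} (f : Fin (a + b) → Bool) → (∀ x → f (x ↑ˡ b) ≡ false) → anyFin f ≡ anyFin (λ y → f (a ↑ʳ y))
anyFin-onRight a f h = trans (anyFin-split a f) (cong (_∨ anyFin (λ y → f (a ↑ʳ y))) (anyFin-none _ h))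

countFin-onLeft : ∀ a {b} (f : Fin (a + b) → Bool) → (∀ y → f (a ↑ʳ y) ≡ false) → countFin f ≡ countFin (λ x → f (x ↑ˡ b))
countFin-onLeft a {b} f h = trans (countFin-split a f) (trans (cong (countFin (λ x → f (x ↑ˡ b)) +_) (countFin-none _ h)) (+-identityʳ _))

countFin-onRight : ∀ a {b} (f : Fin (a + b) → Bool) → (∀ x → f (x ↑ˡ b) ≡ false) → countFin f ≡ countFin (λ y → f (a ↑ʳ y))
countFin-onRight a f h = trans (countFin-split a f) (cong (_+ countFin (λ y → f (a ↑ʳ y))) (countFin-none _ h))

view : ∀ a {b} (u : Fin (a + b)) → (∃ λ x → u ≡ x ↑ˡ b) ⊎ (∃ λ y → u ≡ a ↑ʳ y)
view a u with splitAt a u in eq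
... | inj₁ x = inj₁ (x , sym (splitAt⁻¹-↑ˡ eq))
... | inj₂ y = inj₂ (y , sym (splitAt⁻¹-↑ʳ eq))

module Union {a b : ℕ} (A : Fin a → Fin a → Bool) (B : Fin b → Fin b → Bool) where

  U : Fin (a + b) → Fin (a + b) → Bool
  U = unionAdj A B

  adj-ll : ∀ x y → U (x ↑ˡ b) (y ↑ˡ b) ≡ A x y
  adj-ll x y rewrite splitAt-↑ˡ a x b | splitAt-↑ˡ a y b = refl
  adj-lr : ∀ x y → U (x ↑ˡ b) (a ↑ʳ y) ≡ false
  adj-lr x y rewrite splitAt-↑ˡ a x b | splitAt-↑ʳ a b y = refl
  adj-rl : ∀ x y → U (a ↑ʳ x) (y ↑ˡ b) ≡ false
  adj-rl x y rewrite splitAt-↑ʳ a b x | splitAt-↑ˡ a y b = refl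
  adj-rr : ∀ x y → U (a ↑ʳ x) (a ↑ʳ y) ≡ B x y
  adj-rr x y rewrite splitAt-↑ʳ a b x | splitAt-↑ʳ a b y = refl

  left : (Fin (a + b) → Bool) → Fin a → Bool
  left C x = C (x ↑ˡ b)
  right : (Fin (a + b) → Bool) → Fin b → Bool
  right C y = C (a ↑ʳ y)

  domStep-left : ∀ S x → domStep U S (x ↑ˡ b) ≡ domStep A (left S) x
  domStep-left S x = cong (S (x ↑ˡ b) ∨_) (trans
    (anyFin-onLeft a _ (λ y → trans (cong (S (a ↑ʳ y) ∧_) (adj-rl y x)) (∧-zeroʳ _)))
    (anyFin-cong (λ y → cong (S (y ↑ˡ b) ∧_) (adj-ll y x))))

  domStep-right : ∀ S y → domStep U S (a ↑ʳ y) ≡ domStep B (right S) y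
  domStep-right S y = cong (S (a ↑ʳ y) ∨_) (trans
    (anyFin-onRight a _ (λ x → trans (cong (S (x ↑ˡ b) ∧_) (adj-lr x y)) (∧-zeroʳ _)))
    (anyFin-cong (λ z → cong (S (a ↑ʳ z) ∧_) (adj-rr z y))))

  uncoloured-left : ∀ C x → uncolouredNbrs U C (x ↑ˡ b) ≡ uncolouredNbrs A (left C) x
  uncoloured-left C x = trans
    (countFin-onLeft a _ (λ y → cong (λ t → t ∧ not (C (a ↑ʳ y))) (adj-lr x y)))
    (countFin-cong (λ y → cong (λ t → t ∧ not (C (y ↑ˡ b))) (adj-ll x y)))

  uncoloured-right : ∀ C y → uncolouredNbrs U C (a ↑ʳ y) ≡ uncolouredNbrs B (right C) y
  uncoloured-right C y = trans
    (countFin-onRight a _ (λ x → cong (λ t → t ∧ not (C (x ↑ˡ b))) (adj-rl y x)))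
    (countFin-cong (λ z → cong (λ t → t ∧ not (C (a ↑ʳ z))) (adj-rr y z)))

  forceStep-left : ∀ C x → forceStep U C (x ↑ˡ b) ≡ forceStep A (left C) x
  forceStep-left C x = cong (C (x ↑ˡ b) ∨_) (trans
    (anyFin-onLeft a _ (λ y → trans (cong (λ t → C (a ↑ʳ y) ∧ t ∧ not (C (x ↑ˡ b)) ∧ (uncolouredNbrs U C (a ↑ʳ y) ≡ᵇ 1)) (adj-rl y x)) (∧-zeroʳ _)))
    (anyFin-cong (λ y → cong₂ (λ t j → C (y ↑ˡ b) ∧ t ∧ not (C (x ↑ˡ b)) ∧ (j ≡ᵇ 1)) (adj-ll y x) (uncoloured-left C y))))

  forceStep-right : ∀ C y → forceStep U C (a ↑ʳ y) ≡ forceStep B (right C) y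
  forceStep-right C y = cong (C (a ↑ʳ y) ∨_) (trans
    (anyFin-onRight a _ (λ x → trans (cong (λ t → C (x ↑ˡ b) ∧ t ∧ not (C (a ↑ʳ y)) ∧ (uncolouredNbrs U C (x ↑ˡ b) ≡ᵇ 1)) (adj-lr x y)) (∧-zeroʳ _)))
    (anyFin-cong (λ z → cong₂ (λ t j → C (a ↑ʳ z) ∧ t ∧ not (C (a ↑ʳ y)) ∧ (j ≡ᵇ 1)) (adj-rr z y) (uncoloured-right C z))))

  iter-left : ∀ k C x → iter U k C (x ↑ˡ b) ≡ iter A k (left C) x
  iter-left zero    C x = refl
  iter-left (suc k) C x = trans (iter-left k (forceStep U C) x) (Process.iter-cong A k (forceStep-left C) x)

  iter-right : ∀ k C y → iter U k C (a ↑ʳ y) ≡ iter B k (right C) y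
  iter-right zero    C y = refl
  iter-right (suc k) C y = trans (iter-right k (forceStep U C) y) (Process.iter-cong B k (forceStep-right C) y)

  -- S is power dominating in the union iff both of its parts are; the union
  -- runs a + b rounds, which by stabilisation is as good as a (resp. b).
  isPD-union : ∀ S → isPowerDominatingᵇ U S ≡ isPowerDominatingᵇ A (left S) ∧ isPowerDominatingᵇ B (right S)
  isPD-union S = trans (allFin-split a _) (cong₂ _∧_
    (allFin-cong (λ x → trans (iter-left (a + b) _ x) (trans (Process.iter-cong A (a + b) (domStep-left S) x) (Process.iter-stable A (a + b) _ (m≤m+n a b) x))))
    (allFin-cong (λ y → trans (iter-right (a + b) _ y) (trans (Process.iter-cong B (a + b) (domStep-right S) y) (Process.iter-stable B (a + b) _ (m≤n+m b a) y)))))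

card-++ : ∀ {a b} (s : Vec Bool a) (t : Vec Bool b) → card (s ++ t) ≡ card s + card t
card-++ []          t = refl
card-++ (true ∷ s)  t = cong suc (card-++ s t)
card-++ (false ∷ s) t = card-++ s t

PD-⊕ : ∀ G H (s : Vec Bool (n G)) (t : Vec Bool (n H)) → PD (G ⊕ H) (s ++ t) ≡ PD G s ∧ PD H t
PD-⊕ G H s t = trans (Union.isPD-union (adj G) (adj H) (lookup (s ++ t)))
  (cong₂ _∧_ (Process.isPD-cong (adj G) (lookup-++ˡ s t)) (Process.isPD-cong (adj H) (lookup-++ʳ s t)))

-- The polynomial of a disjoint union is the product of the polynomials,
-- written as a double sum over pairs of subsets.
p-⊕ : ∀ G H i → p (G ⊕ H) i ≡
  sumSubsets (n G) (λ s → sumSubsets (n H) (λ t → χ ((PD G s ∧ PD H t) ∧ does (card s + card t ℕ.≟ i))))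
p-⊕ G H i = trans (p-as-sum (G ⊕ H) i) (trans (sumSubsets-++ (n G) (n H) _)
  (sumSubsets-cong (n G) (λ s → sumSubsets-cong (n H) (λ t →
    cong₂ (λ b c → χ (b ∧ does (c ℕ.≟ i))) (PD-⊕ G H s t) (card-++ s t)))))

⊕-cong : ∀ {A A' B B'} → A ≅ A' → B ≅ B' → (A ⊕ B) ≅ (A' ⊕ B')
⊕-cong {A} {A'} {B} {B'} (f , pf) (g , pg) = h , pres
  where
  h : Fin (n A + n B) ↔ Fin (n A' + n B')
  h = ↔-trans (+↔⊎ {n A} {n B}) (↔-trans (f ⊎-↔ g) (↔-sym (+↔⊎ {n A'} {n B'})))
  h-left : ∀ x → Inverse.to h (x ↑ˡ n B) ≡ Inverse.to f x ↑ˡ n B'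
  h-left x rewrite splitAt-↑ˡ (n A) x (n B) = refl
  h-right : ∀ y → Inverse.to h (n A ↑ʳ y) ≡ n A' ↑ʳ Inverse.to g y
  h-right y rewrite splitAt-↑ʳ (n A) (n B) y = refl
  module X = Union (adj A) (adj B)
  module Y = Union (adj A') (adj B')
  pres : ∀ u v → adj (A' ⊕ B') (Inverse.to h u) (Inverse.to h v) ≡ adj (A ⊕ B) u v
  pres u v with view (n A) u | view (n A) v
  ... | inj₁ (x , refl) | inj₁ (y , refl) rewrite h-left x  | h-left y  = trans (Y.adj-ll _ _) (trans (pf x y) (sym (X.adj-ll x y)))
  ... | inj₁ (x , refl) | inj₂ (y , refl) rewrite h-left x  | h-right y = trans (Y.adj-lr _ _) (sym (X.adj-lr x y))
  ... | inj₂ (x , refl) | inj₁ (y , refl) rewrite h-right x | h-left y  = trans (Y.adj-rl _ _) (sym (X.adj-rl x y))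
  ... | inj₂ (x , refl) | inj₂ (y , refl) rewrite h-right x | h-right y = trans (Y.adj-rr _ _) (trans (pg x y) (sym (X.adj-rr x y)))

⊕-comm : ∀ A B → (A ⊕ B) ≅ (B ⊕ A)
⊕-comm A B = h , pres
  where
  h : Fin (n A + n B) ↔ Fin (n B + n A)
  h = ↔-trans (+↔⊎ {n A} {n B}) (↔-trans (⊎-comm (Fin (n A)) (Fin (n B))) (↔-sym (+↔⊎ {n B} {n A})))
  h-left : ∀ x → Inverse.to h (x ↑ˡ n B) ≡ n B ↑ʳ x
  h-left x rewrite splitAt-↑ˡ (n A) x (n B) = refl
  h-right : ∀ y → Inverse.to h (n A ↑ʳ y) ≡ y ↑ˡ n A
  h-right y rewrite splitAt-↑ʳ (n A) (n B) y = refl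
  module X = Union (adj A) (adj B)
  module Y = Union (adj B) (adj A)
  pres : ∀ u v → adj (B ⊕ A) (Inverse.to h u) (Inverse.to h v) ≡ adj (A ⊕ B) u v
  pres u v with view (n A) u | view (n A) v
  ... | inj₁ (x , refl) | inj₁ (y , refl) rewrite h-left x  | h-left y  = trans (Y.adj-rr x y) (sym (X.adj-ll x y))
  ... | inj₁ (x , refl) | inj₂ (y , refl) rewrite h-left x  | h-right y = trans (Y.adj-rl x y) (sym (X.adj-lr x y))
  ... | inj₂ (x , refl) | inj₁ (y , refl) rewrite h-right x | h-left y  = trans (Y.adj-lr x y) (sym (X.adj-rl x y))
  ... | inj₂ (x , refl) | inj₂ (y , refl) rewrite h-right x | h-right y = trans (Y.adj-ll x y) (sym (X.adj-rr x y))

K₁ K₂ : Graph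
K₁ = K 1 (s≤s z≤n)
K₂ = K 2 (s≤s z≤n)

-- The coefficients of xᶜ·𝒫(G): p(G;i) with every subset shifted up in size by c.
shifted : Graph → ℕ → ℕ → ℕ
shifted G c i = sumSubsets (n G) (λ t → χ (PD G t ∧ does (c + card t ℕ.≟ i)))

shifted-p : ∀ G c j → shifted G c (c + j) ≡ p G j
shifted-p G zero    j = sym (p-as-sum G j)
shifted-p G (suc c) j = shifted-p G c j

shifted-below : ∀ G c j → j < c → shifted G c j ≡ 0
shifted-below G c j j<c = sumSubsets-zero (n G) (λ t → cong χ (trans
  (cong (PD G t ∧_) (dec-false (c + card t ℕ.≟ j) (λ e → <-irrefl refl (<-≤-trans j<c (≤-trans (m≤m+n c (card t)) (≤-reflexive e))))))
  (∧-zeroʳ _)))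

-- 𝒫(K₁ ∪̇ G) = x · 𝒫(G): the single vertex must belong to the set.
p-K₁⊕ : ∀ G i → p (K₁ ⊕ G) i ≡ shifted G 1 i
p-K₁⊕ G i = trans (p-⊕ K₁ G i) (trans (cong (shifted G 1 i +_) (sumSubsets-zero (n G) (λ _ → refl))) (+-identityʳ _))

-- 𝒫(K₂ ∪̇ G) = (x² + 2x) · 𝒫(G): the set meets K₂ in one or two vertices.
p-K₂⊕ : ∀ G i → p (K₂ ⊕ G) i ≡ shifted G 2 i + (shifted G 1 i + shifted G 1 i)
p-K₂⊕ G i = begin
  p (K₂ ⊕ G) i                                    ≡⟨ p-⊕ K₂ G i ⟩
  (S₂ + S₁) + (S₁ + sumSubsets (n G) (λ _ → 0))   ≡⟨ cong (λ z → (S₂ + S₁) + (S₁ + z)) (sumSubsets-zero (n G) (λ _ → refl)) ⟩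
  (S₂ + S₁) + (S₁ + 0)                            ≡⟨ cong ((S₂ + S₁) +_) (+-identityʳ S₁) ⟩
  (S₂ + S₁) + S₁                                  ≡⟨ +-assoc S₂ S₁ S₁ ⟩
  S₂ + (S₁ + S₁)                                  ∎
  where
  open ≡-Reasoning
  S₁ = shifted G 1 i
  S₂ = shifted G 2 i

same-K₁⊕ : ∀ X Y → SamePolynomial X Y → SamePolynomial (K₁ ⊕ X) (K₁ ⊕ Y)
same-K₁⊕ X Y e zero    = trans (p-K₁⊕ X 0) (trans (trans (shifted-below X 1 0 (s≤s z≤n)) (sym (shifted-below Y 1 0 (s≤s z≤n)))) (sym (p-K₁⊕ Y 0)))
same-K₁⊕ X Y e (suc j) = trans (p-K₁⊕ X (suc j)) (trans (shifted-p X 1 j) (trans (e j) (sym (trans (p-K₁⊕ Y (suc j)) (shifted-p Y 1 j)))))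

cancel-K₁⊕ : ∀ X Y → SamePolynomial (K₁ ⊕ X) (K₁ ⊕ Y) → SamePolynomial X Y
cancel-K₁⊕ X Y e j = begin
  p X j                ≡⟨ shifted-p X 1 j ⟨
  shifted X 1 (suc j)  ≡⟨ p-K₁⊕ X (suc j) ⟨
  p (K₁ ⊕ X) (suc j)   ≡⟨ e (suc j) ⟩
  p (K₁ ⊕ Y) (suc j)   ≡⟨ p-K₁⊕ Y (suc j) ⟩
  shifted Y 1 (suc j)  ≡⟨ shifted-p Y 1 j ⟩
  p Y j                ∎
  where open ≡-Reasoning

p-K₂⊕-2+ : ∀ G j → p (K₂ ⊕ G) (2 + j) ≡ p G j + (p G (suc j) + p G (suc j))
p-K₂⊕-2+ G j = trans (p-K₂⊕ G (2 + j)) (cong₂ (λ a b → a + (b + b)) (shifted-p G 2 j) (shifted-p G 1 (suc j)))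

p-K₂⊕-1 : ∀ G → p (K₂ ⊕ G) 1 ≡ p G 0 + p G 0
p-K₂⊕-1 G = trans (p-K₂⊕ G 1) (cong₂ (λ a b → a + (b + b)) (shifted-below G 2 1 (s≤s (s≤s z≤n))) (shifted-p G 1 0))

p-K₂⊕-0 : ∀ G → p (K₂ ⊕ G) 0 ≡ 0
p-K₂⊕-0 G = trans (p-K₂⊕ G 0) (cong₂ (λ a b → a + (b + b)) (shifted-below G 2 0 (s≤s z≤n)) (shifted-below G 1 0 (s≤s z≤n)))

same-K₂⊕ : ∀ X Y → SamePolynomial X Y → SamePolynomial (K₂ ⊕ X) (K₂ ⊕ Y)
same-K₂⊕ X Y e zero          = trans (p-K₂⊕-0 X) (sym (p-K₂⊕-0 Y))
same-K₂⊕ X Y e (suc zero)    = trans (p-K₂⊕-1 X) (trans (cong₂ _+_ (e 0) (e 0)) (sym (p-K₂⊕-1 Y)))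
same-K₂⊕ X Y e (suc (suc j)) = trans (p-K₂⊕-2+ X j) (trans (cong₂ (λ a b → a + (b + b)) (e j) (e (suc j))) (sym (p-K₂⊕-2+ Y j)))

-- Cancelling K₂: the coefficients of X are recovered one by one, since
-- doubling is injective.
cancel-K₂⊕ : ∀ X Y → SamePolynomial (K₂ ⊕ X) (K₂ ⊕ Y) → SamePolynomial X Y
cancel-K₂⊕ X Y e = go
  where
  double-injective : ∀ a b → a + a ≡ b + b → a ≡ b
  double-injective a b h = *-cancelˡ-≡ a b 2 (trans (cong (a +_) (+-identityʳ a)) (trans h (sym (cong (b +_) (+-identityʳ b)))))
  go : ∀ j → p X j ≡ p Y j
  go zero    = double-injective _ _ (trans (sym (p-K₂⊕-1 X)) (trans (e 1) (p-K₂⊕-1 Y)))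
  go (suc j) = double-injective _ _ (+-cancelˡ-≡ (p X j) _ _ (begin
    p X j + (p X (suc j) + p X (suc j))   ≡⟨ p-K₂⊕-2+ X j ⟨
    p (K₂ ⊕ X) (2 + j)                     ≡⟨ e (2 + j) ⟩
    p (K₂ ⊕ Y) (2 + j)                     ≡⟨ p-K₂⊕-2+ Y j ⟩
    p Y j + (p Y (suc j) + p Y (suc j))   ≡⟨ cong (_+ _) (go j) ⟨
    p X j + (p Y (suc j) + p Y (suc j))   ∎))
    where open ≡-Reasoning

allBut : ∀ {k} → Fin k → Fin k → Bool
allBut u x = not (does (x ≟ u))

allBut₂ : ∀ {k} → Fin k → Fin k → Fin k → Bool
allBut₂ u v x = allBut u x ∧ allBut v x

pairSum : ∀ {k} → (Fin k → Fin k → ℕ) → ℕ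
pairSum {zero}  h = 0
pairSum {suc k} h = sum (λ v → h zero (suc v)) + pairSum (λ u v → h (suc u) (suc v))

card-≤ : ∀ {k} (s : Vec Bool k) → card s ≤ k
card-≤ []          = z≤n
card-≤ (true ∷ s)  = s≤s (card-≤ s)
card-≤ (false ∷ s) = m≤n⇒m≤1+n (card-≤ s)

sumSubsets-full : ∀ k (b : Vec Bool k → Bool) →
  sumSubsets k (λ S → χ (b S ∧ does (card S ℕ.≟ k))) ≡ χ (b (tabulate (λ _ → true)))
sumSubsets-full zero    b = cong χ (∧-identityʳ (b []))
sumSubsets-full (suc k) b = trans (cong₂ _+_ (sumSubsets-full k (b ∘ (true ∷_)))
  (sumSubsets-zero k (λ s → cong χ (trans (cong (b (false ∷ s) ∧_) (dec-false (card s ℕ.≟ suc k) (λ e → <-irrefl e (s≤s (card-≤ s))))) (∧-zeroʳ _)))))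
  (+-identityʳ _)

sumSubsets-co₁ : ∀ k (b : Vec Bool (suc k) → Bool) →
  sumSubsets (suc k) (λ S → χ (b S ∧ does (card S ℕ.≟ k))) ≡ sum (λ u → χ (b (tabulate (allBut u))))
sumSubsets-co₁ zero    b = trans (cong (_+ χ (b (false ∷ [])  ∧ true)) (cong χ (∧-zeroʳ (b (true ∷ []))))) (trans (cong χ (∧-identityʳ (b (false ∷ [])))) (sym (+-identityʳ _)))
sumSubsets-co₁ (suc k) b = trans (cong₂ _+_ (sumSubsets-co₁ k (b ∘ (true ∷_))) (sumSubsets-full (suc k) (b ∘ (false ∷_))))
  (+-comm _ (χ (b (false ∷ tabulate (λ _ → true)))))

sumSubsets-co₂ : ∀ k (b : Vec Bool (suc (suc k)) → Bool) →
  sumSubsets (suc (suc k)) (λ S → χ (b S ∧ does (card S ℕ.≟ k))) ≡ pairSum (λ u v → χ (b (tabulate (allBut₂ u v))))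
sumSubsets-co₂ zero    b = trans (cong₂ _+_ (sumSubsets-zero 1 (λ s → cong χ (∧-zeroʳ (b (true ∷ s))))) (sumSubsets-co₁ 0 (b ∘ (false ∷_)))) (sym (+-identityʳ _))
sumSubsets-co₂ (suc k) b = trans (cong₂ _+_ (sumSubsets-co₂ k (b ∘ (true ∷_))) (sumSubsets-co₁ (suc k) (b ∘ (false ∷_))))
  (+-comm (pairSum (λ u v → χ (b (true ∷ tabulate (allBut₂ u v))))) _)

pairSum-cong : ∀ {k} {h h' : Fin k → Fin k → ℕ} → (∀ u v → u ≢ v → h u v ≡ h' u v) → pairSum h ≡ pairSum h'
pairSum-cong {zero}  e = refl
pairSum-cong {suc k} e = cong₂ _+_ (sum-cong-≗ (λ v → e zero (suc v) (λ ())))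
  (pairSum-cong (λ u v u≢v → e (suc u) (suc v) (u≢v ∘ Finₚ.suc-injective)))

pairSum-+ : ∀ {k} (h h' : Fin k → Fin k → ℕ) → pairSum (λ u v → h u v + h' u v) ≡ pairSum h + pairSum h'
pairSum-+ {zero}  h h' = refl
pairSum-+ {suc k} h h' = trans
  (cong₂ _+_ (∑-distrib-+ (λ v → h zero (suc v)) (λ v → h' zero (suc v))) (pairSum-+ (λ u v → h (suc u) (suc v)) (λ u v → h' (suc u) (suc v))))
  (+-interchange (sum (λ v → h zero (suc v))) _ (pairSum (λ u v → h (suc u) (suc v))) _)

choose₂ : ℕ → ℕ
choose₂ zero    = 0
choose₂ (suc k) = k + choose₂ k

pairSum-choose₂ : ∀ {k} (a : Fin k → Bool) → pairSum (λ u v → χ (a u ∧ a v)) ≡ choose₂ (countFin a)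
pairSum-choose₂ {zero}  a = refl
pairSum-choose₂ {suc k} a with a zero
... | true  = cong₂ _+_ (sym (countFin-sum (a ∘ suc))) (pairSum-choose₂ (a ∘ suc))
... | false = trans (cong (_+ pairSum (λ u v → χ (a (suc u) ∧ a (suc v)))) (sum-replicate-zero k)) (pairSum-choose₂ (a ∘ suc))

sum-pos : ∀ {k} (f : Fin k → ℕ) → 1 ≤ sum f → ∃ λ i → 1 ≤ f i
sum-pos {zero}  f ()
sum-pos {suc k} f h with f zero in e
... | suc _ = zero , subst (1 ≤_) (sym e) (s≤s z≤n)
... | zero  = let i , fi = sum-pos (f ∘ suc) h in suc i , fi

pairSum-pos : ∀ {k} (h : Fin k → Fin k → ℕ) → 1 ≤ pairSum h → ∃ λ u → ∃ λ v → 1 ≤ h u v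
pairSum-pos {zero}  h ()
pairSum-pos {suc k} h le with sum (λ v → h zero (suc v)) in e
... | suc _ = let v , q = sum-pos (λ v → h zero (suc v)) (subst (1 ≤_) (sym e) (s≤s z≤n)) in zero , suc v , q
... | zero  = let u , v , q = pairSum-pos (λ u v → h (suc u) (suc v)) le in suc u , suc v , q

nonIsolated : (G : Graph) → Fin (n G) → Bool
nonIsolated G u = anyFin (adj G u)

onlyNeighbour : (G : Graph) → Fin (n G) → Fin (n G) → Bool
onlyNeighbour G u v = allFin (λ w → not (adj G u w) ∨ does (w ≟ v))

isK₂ : (G : Graph) → Fin (n G) → Fin (n G) → Bool
isK₂ G u v = adj G u v ∧ onlyNeighbour G u v ∧ onlyNeighbour G v u

module Observation (G : Graph) where

  adj-≢ : ∀ {x w} → adj G x w ≡ true → x ≢ w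
  adj-≢ {x} e refl with () ← trans (sym e) (irrefl G x)

  private
    edge-to : ∀ {a d} → not a ∨ d ≡ false → a ≡ true × d ≡ false
    edge-to {true} {false} _ = refl , refl

  onlyNeighbour-true : ∀ {u v} → onlyNeighbour G u v ≡ true → ∀ w → adj G u w ≡ true → w ≡ v
  onlyNeighbour-true {u} {v} h w e with ≡-or-≢ w v
  ... | inj₁ w≡v = w≡v
  ... | inj₂ w≢v with () ← trans (sym (allFin-elim _ h w)) (cong₂ (λ a d → not a ∨ d) e (dec-false (w ≟ v) w≢v))

  onlyNeighbour-false : ∀ {u v} → onlyNeighbour G u v ≡ false → ∃ λ w → adj G u w ≡ true × w ≢ v
  onlyNeighbour-false {u} {v} h =
    let w , q = allFin-refute⁻ _ h ; auw , d = edge-to q in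
    w , auw , λ w≡v → contradiction (trans (sym (dec-true (w ≟ v) w≡v)) d) λ ()

  sole-neighbour : ∀ {u v} → nonIsolated G u ≡ true → onlyNeighbour G u v ≡ true → adj G u v ≡ true
  sole-neighbour {u} nu ou = let w , auw = anyFin-elim (adj G u) nu in subst (λ z → adj G u z ≡ true) (onlyNeighbour-true ou w auw) auw

  isK₂-intro : ∀ {u v} → adj G u v ≡ true → onlyNeighbour G u v ≡ true → onlyNeighbour G v u ≡ true → isK₂ G u v ≡ true
  isK₂-intro a b c rewrite a | b | c = refl

  isK₂-sym : ∀ u v → isK₂ G u v ≡ isK₂ G v u
  isK₂-sym u v = bool-ext (one-way u v) (one-way v u)
    where
    one-way : ∀ u v → isK₂ G u v ≡ true → isK₂ G v u ≡ true
    one-way u v h = let a , bc = ∧-true h ; b , c = ∧-true bc in isK₂-intro (trans (adj-sym G v u) a) c b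

  -- Sets that are closed under taking neighbours and avoid S are never coloured.
  module Trap (T : Fin (n G) → Set) (closed : ∀ w x → T x → adj G w x ≡ true → T w)
              (S : Fin (n G) → Bool) (avoid : ∀ x → T x → S x ≡ false) where

    private
      Avoids : (Fin (n G) → Bool) → Set
      Avoids C = ∀ x → T x → C x ≡ false

      guarded : ∀ C → Avoids C → ∀ w x → T x → (r : Bool) → C w ∧ adj G w x ∧ r ≡ false
      guarded C av w x tx r with adj G w x in e
      ... | false = ∧-zeroʳ (C w)
      ... | true  rewrite av w (closed w x tx e) = refl

      avoids-dom : Avoids (domStep (adj G) S)
      avoids-dom x tx rewrite avoid x tx = anyFin-none _ λ w →
        trans (cong (S w ∧_) (sym (∧-identityʳ (adj G w x)))) (guarded S avoid w x tx true)

      avoids-force : ∀ C → Avoids C → Avoids (forceStep (adj G) C)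
      avoids-force C av x tx rewrite av x tx = anyFin-none _ λ w → guarded C av w x tx _

      avoids-iter : ∀ k C → Avoids C → Avoids (iter (adj G) k C)
      avoids-iter zero    C av = av
      avoids-iter (suc k) C av = avoids-iter k (forceStep (adj G) C) (avoids-force C av)

    not-PD : ∀ x → T x → isPowerDominatingᵇ (adj G) S ≡ false
    not-PD x tx = allFin-refute _ x (avoids-iter (n G) _ avoids-dom x tx)

  Forces : (Fin (n G) → Bool) → Fin (n G) → Fin (n G) → Set
  Forces C y x = C y ≡ true × adj G y x ≡ true × (∀ z → adj G y z ≡ true → C z ≡ false → z ≡ x)

  -- If after domination every vertex is coloured or forced, S is power
  -- dominating: the first forcing round already colours everything.
  one-round : ∀ S → (∀ x → domStep (adj G) S x ≡ true ⊎ ∃ λ y → Forces (domStep (adj G) S) y x) → isPowerDominatingᵇ (adj G) S ≡ true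
  one-round S h = allFin-intro _ (after-first-round (n G) (nonempty G))
    where
    C = domStep (adj G) S
    coloured : ∀ x → forceStep (adj G) C x ≡ true
    coloured x with h x
    ... | inj₁ e = Process.forceStep-inflationary (adj G) C x e
    ... | inj₂ (y , cy , ayx , only-x) with C x in cx
    ...   | true  = refl
    ...   | false = anyFin-intro _ y (trans (cong₂ (λ a b → a ∧ b ∧ true ∧ (uncolouredNbrs (adj G) C y ≡ᵇ 1)) cy ayx)
              (cong (_≡ᵇ 1) (countFin-unique _ x (cong₂ _∧_ ayx (cong not cx))
                (λ z q → let ayz , ¬cz = ∧-true q in only-x z ayz (not-true ¬cz)))))
      where
      not-true : ∀ {b} → not b ≡ true → b ≡ false
      not-true {false} _ = refl
    after-first-round : ∀ k → 1 ≤ k → ∀ x → iter (adj G) k C x ≡ true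
    after-first-round (suc k) _ x = Process.iter-inflationary (adj G) k _ x (coloured x)

  dominated : ∀ S x w → adj G x w ≡ true → S w ≡ true → domStep (adj G) S x ≡ true
  dominated S x w axw sw with S x
  ... | true  = refl
  ... | false = anyFin-intro _ w (trans (cong₂ _∧_ sw (adj-sym G w x)) axw)

  self-dominated : ∀ S x → S x ≡ true → domStep (adj G) S x ≡ true
  self-dominated S x e rewrite e = refl

  ∨-false : ∀ {a b} → a ∨ b ≡ false → a ≡ false
  ∨-false {false} _ = refl

  empty-not-PD : ∀ S → (∀ x → S x ≡ false) → isPowerDominatingᵇ (adj G) S ≡ false
  empty-not-PD S h = Trap.not-PD (λ _ → ⊤) (λ _ _ _ _ → tt) S (λ x _ → h x) (vertex (nonempty G)) tt
    where
    vertex : ∀ {k} → 1 ≤ k → Fin k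
    vertex (s≤s _) = zero

  isolated-closed : ∀ {u} → nonIsolated G u ≡ false → ∀ w x → x ≡ u → adj G w x ≡ true → w ≡ u
  isolated-closed {u} e w x refl awu with () ← trans (sym (anyFin-intro (adj G u) w (trans (adj-sym G u w) awu))) e

  allBut-PD : ∀ u → isPowerDominatingᵇ (adj G) (allBut u) ≡ nonIsolated G u
  allBut-PD u with nonIsolated G u in e
  ... | true  = let w , auw = anyFin-elim (adj G u) e in one-round _ (λ x → inj₁ (covered x w auw))
    where
    covered : ∀ x w → adj G u w ≡ true → domStep (adj G) (allBut u) x ≡ true
    covered x w auw with ≡-or-≢ x u
    ... | inj₂ x≢u = self-dominated (allBut u) x (cong not (dec-false (x ≟ u) x≢u))
    ... | inj₁ refl = dominated (allBut u) u w auw (cong not (dec-false (w ≟ u) (adj-≢ auw ∘ sym)))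
  ... | false = Trap.not-PD (_≡ u) (isolated-closed e) (allBut u) (λ { x refl → cong not (dec-true (u ≟ u) refl) }) u refl

  covered-or-forced : ∀ S u v → nonIsolated G u ≡ true → isK₂ G u v ≡ false →
    (∀ z → z ≢ u → z ≢ v → S z ≡ true) → (∀ z → S z ≡ false → z ≡ u ⊎ z ≡ v) →
    domStep (adj G) S u ≡ true ⊎ ∃ λ y → Forces (domStep (adj G) S) y u
  covered-or-forced S u v nu k₂ in-S out-S with true-or-false (onlyNeighbour G u v)
  ... | inj₂ ou = let w , auw , w≢v = onlyNeighbour-false ou in
    inj₁ (dominated S u w auw (in-S w (adj-≢ auw ∘ sym) w≢v))
  ... | inj₁ ou with true-or-false (onlyNeighbour G v u)
  ...   | inj₁ ov with () ← trans (sym (isK₂-intro (sole-neighbour nu ou) ou ov)) k₂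
  ...   | inj₂ ov = inj₂ (v , dom-v , trans (adj-sym G v u) (sole-neighbour nu ou) , only-u)
    where
    dom-v : domStep (adj G) S v ≡ true
    dom-v = let w , avw , w≢u = onlyNeighbour-false ov in dominated S v w avw (in-S w w≢u (adj-≢ avw ∘ sym))
    only-u : ∀ z → adj G v z ≡ true → domStep (adj G) S z ≡ false → z ≡ u
    only-u z _ cz with out-S z (∨-false cz)
    ... | inj₁ z≡u  = z≡u
    ... | inj₂ refl with () ← trans (sym dom-v) cz

  allBut₂-PD : ∀ u v → u ≢ v → isPowerDominatingᵇ (adj G) (allBut₂ u v) ≡ nonIsolated G u ∧ nonIsolated G v ∧ not (isK₂ G u v)
  allBut₂-PD u v u≢v with nonIsolated G u in eu | nonIsolated G v in ev | isK₂ G u v in ek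
  ... | false | _     | _     = Trap.not-PD (_≡ u) (isolated-closed eu) _ (λ { x refl → cong (λ b → not b ∧ allBut v u) (dec-true (u ≟ u) refl) }) u refl
  ... | true  | false | _     = Trap.not-PD (_≡ v) (isolated-closed ev) _ (λ { x refl → trans (cong (λ b → allBut u v ∧ not b) (dec-true (v ≟ v) refl)) (∧-zeroʳ (allBut u v)) }) v refl
  ... | true  | true  | true  = Trap.not-PD (λ x → x ≡ u ⊎ x ≡ v) K₂-closed _ avoid u (inj₁ refl)
    where
    only : (onlyNeighbour G u v ≡ true) × (onlyNeighbour G v u ≡ true)
    only = ∧-true (proj₂ (∧-true {adj G u v} ek))
    K₂-closed : ∀ w x → x ≡ u ⊎ x ≡ v → adj G w x ≡ true → w ≡ u ⊎ w ≡ v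
    K₂-closed w x (inj₁ refl) awx = inj₂ (onlyNeighbour-true (proj₁ only) w (trans (adj-sym G x w) awx))
    K₂-closed w x (inj₂ refl) awx = inj₁ (onlyNeighbour-true (proj₂ only) w (trans (adj-sym G x w) awx))
    avoid : ∀ x → x ≡ u ⊎ x ≡ v → allBut₂ u v x ≡ false
    avoid x (inj₁ refl) = cong (λ b → not b ∧ allBut v u) (dec-true (u ≟ u) refl)
    avoid x (inj₂ refl) = trans (cong (λ b → allBut u v ∧ not b) (dec-true (v ≟ v) refl)) (∧-zeroʳ (allBut u v))
  ... | true  | true  | false = one-round _ each
    where
    in-S : ∀ z → z ≢ u → z ≢ v → allBut₂ u v z ≡ true
    in-S z z≢u z≢v = cong₂ _∧_ (cong not (dec-false (z ≟ u) z≢u)) (cong not (dec-false (z ≟ v) z≢v))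
    out-S : ∀ z → allBut₂ u v z ≡ false → z ≡ u ⊎ z ≡ v
    out-S z e with ≡-or-≢ z u | ≡-or-≢ z v
    ... | inj₁ z≡u | _        = inj₁ z≡u
    ... | inj₂ _   | inj₁ z≡v = inj₂ z≡v
    ... | inj₂ z≢u | inj₂ z≢v with () ← trans (sym (in-S z z≢u z≢v)) e
    each : ∀ x → domStep (adj G) (allBut₂ u v) x ≡ true ⊎ ∃ λ y → Forces (domStep (adj G) (allBut₂ u v)) y x
    each x with ≡-or-≢ x u | ≡-or-≢ x v
    ... | inj₁ refl | _         = covered-or-forced _ u v eu ek in-S out-S
    ... | inj₂ _    | inj₁ refl = covered-or-forced _ v u ev (trans (isK₂-sym v u) ek) (λ z z≢v z≢u → in-S z z≢u z≢v)
                                    (λ z e → swap (out-S z e))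
    ... | inj₂ x≢u  | inj₂ x≢v  = inj₁ (self-dominated _ x (in-S x x≢u x≢v))

p-full : ∀ G → p G (n G) ≡ 1
p-full G = trans (p-as-sum G (n G)) (trans (sumSubsets-full (n G) (PD G)) (cong χ full-PD))
  where
  full-PD : PD G (tabulate (λ _ → true)) ≡ true
  full-PD = allFin-intro _ (λ x → Process.iter-inflationary (adj G) (n G) _ x
    (Observation.self-dominated G _ x (lookup∘tabulate (λ _ → true) x)))

p-above : ∀ G j → n G < j → p G j ≡ 0
p-above G j n<j = trans (p-as-sum G j) (sumSubsets-zero (n G) (λ S → cong χ (trans
  (cong (PD G S ∧_) (dec-false (card S ℕ.≟ j) (λ e → <-irrefl e (≤-<-trans (card-≤ S) n<j)))) (∧-zeroʳ _))))

-- The polynomial determines the number of vertices: it is the degree.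
same-order : ∀ H G → SamePolynomial H G → n H ≡ n G
same-order H G e with <-cmp (n H) (n G)
... | tri≈ _ eq _ = eq
... | tri< lt _ _ with () ← trans (sym (p-above H (n G) lt)) (trans (e (n G)) (p-full G))
... | tri> _ _ gt with () ← trans (sym (p-full H)) (trans (e (n H)) (p-above G (n H) gt))

-- p(G; n − 1) counts the non-isolated vertices (complements of singletons).
p-co₁ : ∀ G → p G (n G ∸ 1) ≡ countFin (nonIsolated G)
p-co₁ record { n = zero ; nonempty = () }
p-co₁ G@record { n = suc m } = begin
  p G m                                              ≡⟨ p-as-sum G m ⟩
  sumSubsets (suc m) (λ S → χ (PD G S ∧ does (card S ℕ.≟ m)))
                                                     ≡⟨ sumSubsets-co₁ m (PD G) ⟩
  sum (λ u → χ (PD G (tabulate (allBut u))))          ≡⟨ sum-cong-≗ (λ u → cong χ (trans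
                                                          (Process.isPD-cong (adj G) (lookup∘tabulate (allBut u)))
                                                          (Observation.allBut-PD G u))) ⟩
  sum (χ ∘ nonIsolated G)                            ≡⟨ countFin-sum (nonIsolated G) ⟨
  countFin (nonIsolated G)                           ∎
  where open ≡-Reasoning

K₂-pairs non-K₂-pairs : Graph → ℕ
K₂-pairs G     = pairSum (λ u v → χ (nonIsolated G u ∧ nonIsolated G v ∧ isK₂ G u v))
non-K₂-pairs G = pairSum (λ u v → χ (nonIsolated G u ∧ nonIsolated G v ∧ not (isK₂ G u v)))

-- p(G; n − 2) counts the pairs of non-isolated vertices that are not a K₂
-- component (complements of pairs).
p-co₂ : ∀ G → 2 ≤ n G → p G (n G ∸ 2) ≡ non-K₂-pairs G
p-co₂ record { n = zero } ()
p-co₂ record { n = suc zero } (s≤s ())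
p-co₂ G@record { n = suc (suc m) } _ = begin
  p G m                                                   ≡⟨ p-as-sum G m ⟩
  sumSubsets (suc (suc m)) (λ S → χ (PD G S ∧ does (card S ℕ.≟ m)))
                                                          ≡⟨ sumSubsets-co₂ m (PD G) ⟩
  pairSum (λ u v → χ (PD G (tabulate (allBut₂ u v))))     ≡⟨ pairSum-cong (λ u v u≢v → cong χ (trans
                                                               (Process.isPD-cong (adj G) (lookup∘tabulate (allBut₂ u v)))
                                                               (Observation.allBut₂-PD G u v u≢v))) ⟩
  non-K₂-pairs G                                          ∎
  where open ≡-Reasoning

K₂-pairs-complement : ∀ G → non-K₂-pairs G + K₂-pairs G ≡ choose₂ (countFin (nonIsolated G))
K₂-pairs-complement G = trans (sym (pairSum-+ (λ u v → χ (nonIsolated G u ∧ nonIsolated G v ∧ not (isK₂ G u v))) (λ u v → χ (nonIsolated G u ∧ nonIsolated G v ∧ isK₂ G u v)))) (trans (pairSum-cong (λ u v _ → split (nonIsolated G u) (nonIsolated G v) (isK₂ G u v)))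
  (pairSum-choose₂ (nonIsolated G)))
  where
  split : ∀ a b c → χ (a ∧ b ∧ not c) + χ (a ∧ b ∧ c) ≡ χ (a ∧ b)
  split true  true  true  = refl
  split true  true  false = refl
  split true  false c     = refl
  split false b     c     = refl

same-nonIsolated : ∀ H G → SamePolynomial H G → countFin (nonIsolated H) ≡ countFin (nonIsolated G)
same-nonIsolated H G e = begin
  countFin (nonIsolated H)  ≡⟨ p-co₁ H ⟨
  p H (n H ∸ 1)             ≡⟨ cong (λ k → p H (k ∸ 1)) (same-order H G e) ⟩
  p H (n G ∸ 1)             ≡⟨ e (n G ∸ 1) ⟩
  p G (n G ∸ 1)             ≡⟨ p-co₁ G ⟩
  countFin (nonIsolated G)  ∎
  where open ≡-Reasoning

same-K₂-pairs : ∀ H G → SamePolynomial H G → 2 ≤ n G → K₂-pairs H ≡ K₂-pairs G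
same-K₂-pairs H G e 2≤n = +-cancelˡ-≡ (non-K₂-pairs G) _ _ (begin
  non-K₂-pairs G + K₂-pairs H                ≡⟨ cong (_+ K₂-pairs H) non-K₂-eq ⟨
  non-K₂-pairs H + K₂-pairs H                ≡⟨ K₂-pairs-complement H ⟩
  choose₂ (countFin (nonIsolated H))         ≡⟨ cong choose₂ (same-nonIsolated H G e) ⟩
  choose₂ (countFin (nonIsolated G))         ≡⟨ K₂-pairs-complement G ⟨
  non-K₂-pairs G + K₂-pairs G                ∎)
  where
  open ≡-Reasoning
  order = same-order H G e
  non-K₂-eq : non-K₂-pairs H ≡ non-K₂-pairs G
  non-K₂-eq = begin
    non-K₂-pairs H     ≡⟨ p-co₂ H (subst (2 ≤_) (sym order) 2≤n) ⟨
    p H (n H ∸ 2)      ≡⟨ cong (λ k → p H (k ∸ 2)) order ⟩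
    p H (n G ∸ 2)      ≡⟨ e (n G ∸ 2) ⟩
    p G (n G ∸ 2)      ≡⟨ p-co₂ G 2≤n ⟩
    non-K₂-pairs G     ∎

-- A graph with the polynomial of K₁ ∪̇ G has an isolated vertex, since
-- K₁ ∪̇ G has fewer non-isolated vertices than vertices.
has-isolated : ∀ H G → SamePolynomial H (K₁ ⊕ G) → ∃ λ u → nonIsolated H u ≡ false
has-isolated H G e with allFin (nonIsolated H) in all-non-isolated
... | false = allFin-refute⁻ _ all-non-isolated
... | true  = ⊥-elim (<-irrefl refl (begin-strict
  n H                                   ≡⟨ countFin-all _ (allFin-elim _ all-non-isolated) ⟨
  countFin (nonIsolated H)              ≡⟨ same-nonIsolated H (K₁ ⊕ G) e ⟩
  countFin (nonIsolated (K₁ ⊕ G))       <⟨ countFin-< (nonIsolated (K₁ ⊕ G)) zero (anyFin-none (adj (K₁ ⊕ G) zero) (λ { zero → refl ; (suc y) → refl })) ⟩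
  n (K₁ ⊕ G)                            ≡⟨ same-order H (K₁ ⊕ G) e ⟨
  n H                                   ∎))
  where open ≤-Reasoning

-- A graph with the polynomial of K₂ ∪̇ G has a K₂ component, since
-- K₂ ∪̇ G has one.
has-K₂ : ∀ H G → SamePolynomial H (K₂ ⊕ G) → ∃ λ u → ∃ λ v → isK₂ H u v ≡ true
has-K₂ H G e =
  let u , v , pos = pairSum-pos _ (subst (1 ≤_) (sym (same-K₂-pairs H (K₂ ⊕ G) e (s≤s (s≤s z≤n)))) first-pair)
  in u , v , third (nonIsolated H u) (nonIsolated H v) (isK₂ H u v) pos
  where
  X = K₂ ⊕ G
  K₂-01 : isK₂ X zero (suc zero) ≡ true
  K₂-01 = Observation.isK₂-intro X {zero} {suc zero} refl
    (allFin-intro (λ w → not (adj X zero w) ∨ does (w ≟ suc zero)) (λ { zero → refl ; (suc zero) → refl ; (suc (suc y)) → refl }))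
    (allFin-intro (λ w → not (adj X (suc zero) w) ∨ does (w ≟ zero)) (λ { zero → refl ; (suc zero) → refl ; (suc (suc y)) → refl }))
  first-pair : 1 ≤ K₂-pairs X
  first-pair = ≤-trans (≤-reflexive (cong (λ b → χ (true ∧ true ∧ b)) (sym K₂-01))) (≤-trans (m≤m+n _ _) (m≤m+n _ _))
  third : ∀ a b c → 1 ≤ χ (a ∧ b ∧ c) → c ≡ true
  third true true true _ = refl

not-adjacent : ∀ G {u v z} → onlyNeighbour G u v ≡ true → z ≢ v → adj G u z ≡ false
not-adjacent G {u} {v} {z} h z≢v with true-or-false (adj G u z)
... | inj₁ e = contradiction (Observation.onlyNeighbour-true G h z e) z≢v
... | inj₂ e = e

-- A graph with an isolated vertex v and at least two vertices is K₁ ∪̇ H′;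
-- the isomorphism sends 0 to v and the remaining vertices in order.
split-K₁ : ∀ H v → nonIsolated H v ≡ false → 2 ≤ n H → ∃ λ H′ → (K₁ ⊕ H′) ≅ H
split-K₁ record { n = zero ; nonempty = () } v iso _
split-K₁ record { n = suc zero } v iso (s≤s ())
split-K₁ record { n = suc (suc m) ; adj = a ; sym = s ; irrefl = ir } v iso _ = H′ , Perm.insert zero v Perm.id , pres
  where
  H′ : Graph
  H′ = record { n = suc m ; nonempty = s≤s z≤n ; adj = λ x y → a (punchIn v x) (punchIn v y)
              ; sym = λ x y → s _ _ ; irrefl = λ x → ir _ }
  pres : ∀ x y → a (Perm.insert zero v Perm.id ⟨$⟩ʳ x) (Perm.insert zero v Perm.id ⟨$⟩ʳ y) ≡ adj (K₁ ⊕ H′) x y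
  pres zero    zero    = ir v
  pres zero    (suc y) = anyFin-none⁻ (a v) iso _
  pres (suc x) zero    = trans (s _ v) (anyFin-none⁻ (a v) iso _)
  pres (suc x) (suc y) = refl

-- A graph with a K₂ component {v, w} and at least three vertices is K₂ ∪̇ H″;
-- the isomorphism sends 0, 1 to v, w and the remaining vertices in order.
split-K₂ : ∀ H v w → isK₂ H v w ≡ true → 3 ≤ n H → ∃ λ H″ → (K₂ ⊕ H″) ≅ H
split-K₂ record { n = zero ; nonempty = () } v w k₂ _
split-K₂ record { n = suc zero } v w k₂ (s≤s ())
split-K₂ record { n = suc (suc zero) } v w k₂ (s≤s (s≤s ()))
split-K₂ H@record { n = suc (suc (suc m)) ; adj = a ; sym = s ; irrefl = ir } v w k₂ _ = H″ , σ , pres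
  where
  parts = ∧-true k₂
  avw = proj₁ parts
  only = ∧-true (proj₂ parts)
  v≢w : v ≢ w
  v≢w = Observation.adj-≢ H avw
  j = punchOut v≢w
  σ = Perm.insert zero v (Perm.insert zero j Perm.id)
  σ₁ : σ ⟨$⟩ʳ suc zero ≡ w
  σ₁ = punchIn-punchOut v≢w
  rest : Fin (suc m) → Fin (suc (suc (suc m)))
  rest x = punchIn v (punchIn j x)
  rest≢v : ∀ x → rest x ≢ v
  rest≢v x = punchInᵢ≢i v _
  rest≢w : ∀ x → rest x ≢ w
  rest≢w x e = punchInᵢ≢i j x (punchIn-injective v _ _ (trans e (sym σ₁)))
  H″ : Graph
  H″ = record { n = suc m ; nonempty = s≤s z≤n ; adj = λ x y → a (rest x) (rest y)
              ; sym = λ x y → s _ _ ; irrefl = λ x → ir _ }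
  v-rest : ∀ x → a v (rest x) ≡ false
  v-rest x = not-adjacent H (proj₁ only) (rest≢w x)
  w-rest : ∀ x → a w (rest x) ≡ false
  w-rest x = not-adjacent H (proj₂ only) (rest≢v x)
  pres : ∀ x y → a (σ ⟨$⟩ʳ x) (σ ⟨$⟩ʳ y) ≡ adj (K₂ ⊕ H″) x y
  pres zero                zero                = ir v
  pres zero                (suc zero)          = trans (cong (a v) σ₁) avw
  pres zero                (suc (suc y))       = v-rest y
  pres (suc zero)          zero                = trans (cong (λ z → a z v) σ₁) (trans (s w v) avw)
  pres (suc zero)          (suc zero)          = ir _
  pres (suc zero)          (suc (suc y))       = trans (cong (λ z → a z (rest y)) σ₁) (w-rest y)
  pres (suc (suc x))       zero                = trans (s _ v) (v-rest x)
  pres (suc (suc x))       (suc zero)          = trans (cong (a (rest x)) σ₁) (trans (s _ w) (w-rest x))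
  pres (suc (suc x))       (suc (suc y))       = refl

transpose-i : ∀ {k} (i j : Fin k) → PC.transpose i j i ≡ j
transpose-i i j rewrite dec-true (i ≟ i) refl = refl

transpose-j : ∀ {k} (i j : Fin k) → PC.transpose i j j ≡ i
transpose-j i j with ≡-or-≢ j i
... | inj₁ refl rewrite dec-true (j ≟ j) refl = refl
... | inj₂ j≢i  rewrite dec-false (j ≟ i) j≢i | dec-true (j ≟ j) refl = refl

transpose-k : ∀ {k} (i j x : Fin k) → x ≢ i → x ≢ j → PC.transpose i j x ≡ x
transpose-k i j x x≢i x≢j rewrite dec-false (x ≟ i) x≢i | dec-false (x ≟ j) x≢j = refl

≅-adj : ∀ {H G} ((f , _) : H ≅ G) u z → adj G (Inverse.to f u) z ≡ adj H u (Inverse.from f z)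
≅-adj {H} {G} (f , pf) u z = trans (cong (adj G (f ⟨$⟩ʳ u)) (sym (inverseʳ f))) (pf u (f ⟨$⟩ˡ z))

twin-automorphism : ∀ X x y → (∀ z → z ≢ x → z ≢ y → adj X x z ≡ adj X y z) → X ≅ X
twin-automorphism X x y twins = transpose x y , aut
  where
  τ = PC.transpose x y
  A = adj X
  twins′ : ∀ z → z ≢ x → z ≢ y → A z x ≡ A z y
  twins′ z z≢x z≢y = trans (adj-sym X z x) (trans (twins z z≢x z≢y) (adj-sym X y z))
  aut : ∀ a b → A (τ a) (τ b) ≡ A a b
  aut a b with ≡-or-≢ a x | ≡-or-≢ b x
  ... | inj₁ refl | inj₁ refl rewrite transpose-i a y = trans (irrefl X y) (sym (irrefl X a))
  ... | inj₁ refl | inj₂ b≢x with ≡-or-≢ b y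
  ...   | inj₁ refl rewrite transpose-i a b | transpose-j a b = adj-sym X b a
  ...   | inj₂ b≢y  rewrite transpose-i a y | transpose-k a y b b≢x b≢y = sym (twins b b≢x b≢y)
  aut a b | inj₂ a≢x | inj₁ refl with ≡-or-≢ a y
  ...   | inj₁ refl rewrite transpose-i b a | transpose-j b a = adj-sym X b a
  ...   | inj₂ a≢y  rewrite transpose-i b y | transpose-k b y a a≢x a≢y = sym (twins′ a a≢x a≢y)
  aut a b | inj₂ a≢x | inj₂ b≢x with ≡-or-≢ a y | ≡-or-≢ b y
  ... | inj₁ refl | inj₁ refl rewrite transpose-j x a = trans (irrefl X x) (sym (irrefl X a))
  ... | inj₁ refl | inj₂ b≢y  rewrite transpose-j x a | transpose-k x a b b≢x b≢y = twins b b≢x b≢y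
  ... | inj₂ a≢y  | inj₁ refl rewrite transpose-j x b | transpose-k x b a a≢x a≢y = twins′ a a≢x a≢y
  ... | inj₂ a≢y  | inj₂ b≢y  rewrite transpose-k x y a a≢x a≢y | transpose-k x y b b≢x b≢y = refl

module MatchingAutomorphism (X : Graph) (σ : Permutation (n X) (n X))
  (M : Fin (n X) → Set) (M? : ∀ z → M z ⊎ ¬ M z) (partner : ∀ {a} → M a → Fin (n X))
  (partner-only : ∀ {a} (m : M a) z → adj X a z ≡ true → z ≡ partner m)
  (partner-adj : ∀ {a} (m : M a) → adj X a (partner m) ≡ true)
  (σ-M : ∀ {a} → M a → M (σ ⟨$⟩ʳ a))
  (σ-partner : ∀ {a} (m : M a) → σ ⟨$⟩ʳ partner m ≡ partner (σ-M m))
  (σ-fix : ∀ {a} → ¬ M a → σ ⟨$⟩ʳ a ≡ a) where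

  private
    A = adj X
    σʳ = σ ⟨$⟩ʳ_
    σ-injective : ∀ {a b} → σʳ a ≡ σʳ b → a ≡ b
    σ-injective {a} {b} e = trans (sym (inverseˡ σ)) (trans (cong (σ ⟨$⟩ˡ_) e) (inverseˡ σ))

    from-M : ∀ {a} (m : M a) b → A (σʳ a) (σʳ b) ≡ A a b
    from-M {a} m b = bool-ext
      (λ e → subst (λ z → A a z ≡ true) (sym (σ-injective (trans (partner-only (σ-M m) _ e) (sym (σ-partner m))))) (partner-adj m))
      (λ e → subst (λ z → A (σʳ a) z ≡ true) (sym (trans (cong σʳ (partner-only m b e)) (σ-partner m))) (partner-adj (σ-M m)))

  automorphism : X ≅ X
  automorphism = σ , aut
    where
    aut : ∀ a b → A (σʳ a) (σʳ b) ≡ A a b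
    aut a b with M? a | M? b
    ... | inj₁ m | _      = from-M m b
    ... | inj₂ _ | inj₁ m = trans (adj-sym X (σʳ a) (σʳ b)) (trans (from-M m a) (adj-sym X b a))
    ... | inj₂ a∉M | inj₂ b∉M rewrite σ-fix a∉M | σ-fix b∉M = refl

-- Any K₂ component {x, x′} of K₂ ∪̇ G is moved onto the first one by an
-- automorphism: the identity, the transposition of 0 and 1, or the
-- exchange of the two components.
module K₂-to-front (G : Graph) where

  private
    X = K₂ ⊕ G
    A = adj X

  adj-0 : ∀ z → A zero z ≡ true → z ≡ suc zero
  adj-0 zero          ()
  adj-0 (suc zero)    _ = refl
  adj-0 (suc (suc z)) ()
  adj-1 : ∀ z → A (suc zero) z ≡ true → z ≡ zero
  adj-1 zero          _ = refl
  adj-1 (suc zero)    ()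
  adj-1 (suc (suc z)) ()

  module Exchange (x x′ : Fin (n X)) (axx′ : A x x′ ≡ true)
    (x-only : ∀ z → A x z ≡ true → z ≡ x′) (x′-only : ∀ z → A x′ z ≡ true → z ≡ x)
    (x≢0 : x ≢ zero) (x≢1 : x ≢ suc zero) (x′≢0 : x′ ≢ zero) (x′≢1 : x′ ≢ suc zero) where

    x≢x′ : x ≢ x′
    x≢x′ = Observation.adj-≢ X axx′

    σ = transpose zero x ∘ₚ transpose (suc zero) x′
    σʳ = σ ⟨$⟩ʳ_

    data M : Fin (n X) → Set where
      at-0  : M zero
      at-1  : M (suc zero)
      at-x  : M x
      at-x′ : M x′

    M? : ∀ z → M z ⊎ ¬ M z
    M? z with ≡-or-≢ z zero | ≡-or-≢ z (suc zero) | ≡-or-≢ z x | ≡-or-≢ z x′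
    ... | inj₁ refl | _ | _ | _ = inj₁ at-0
    ... | inj₂ _ | inj₁ refl | _ | _ = inj₁ at-1
    ... | inj₂ _ | inj₂ _ | inj₁ refl | _ = inj₁ at-x
    ... | inj₂ _ | inj₂ _ | inj₂ _ | inj₁ refl = inj₁ at-x′
    ... | inj₂ z≢0 | inj₂ z≢1 | inj₂ z≢x | inj₂ z≢x′ = inj₂ λ
      { at-0 → z≢0 refl ; at-1 → z≢1 refl ; at-x → z≢x refl ; at-x′ → z≢x′ refl }

    partner : ∀ {a} → M a → Fin (n X)
    partner at-0  = suc zero
    partner at-1  = zero
    partner at-x  = x′
    partner at-x′ = x

    partner-only : ∀ {a} (m : M a) z → A a z ≡ true → z ≡ partner m
    partner-only at-0  = adj-0
    partner-only at-1  = adj-1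
    partner-only at-x  = x-only
    partner-only at-x′ = x′-only

    partner-adj : ∀ {a} (m : M a) → A a (partner m) ≡ true
    partner-adj at-0  = refl
    partner-adj at-1  = refl
    partner-adj at-x  = axx′
    partner-adj at-x′ = trans (adj-sym X x′ x) axx′

    σ-0 : σʳ zero ≡ x
    σ-0 = trans (cong (PC.transpose (suc zero) x′) (transpose-i zero x)) (transpose-k (suc zero) x′ x x≢1 x≢x′)
    σ-1 : σʳ (suc zero) ≡ x′
    σ-1 = trans (cong (PC.transpose (suc zero) x′) (transpose-k zero x (suc zero) (λ ()) (x≢1 ∘ sym))) (transpose-i (suc zero) x′)
    σ-x : σʳ x ≡ zero
    σ-x = trans (cong (PC.transpose (suc zero) x′) (transpose-j zero x)) (transpose-k (suc zero) x′ zero (λ ()) (x′≢0 ∘ sym))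
    σ-x′ : σʳ x′ ≡ suc zero
    σ-x′ = trans (cong (PC.transpose (suc zero) x′) (transpose-k zero x x′ x′≢0 (x≢x′ ∘ sym))) (transpose-j (suc zero) x′)

    σ-M : ∀ {a} → M a → M (σʳ a)
    σ-M at-0  = subst M (sym σ-0) at-x
    σ-M at-1  = subst M (sym σ-1) at-x′
    σ-M at-x  = subst M (sym σ-x) at-0
    σ-M at-x′ = subst M (sym σ-x′) at-1

    partner-subst : ∀ {a b} (e : a ≡ b) (m : M b) → partner (subst M (sym e) m) ≡ partner m
    partner-subst refl m = refl

    σ-partner : ∀ {a} (m : M a) → σʳ (partner m) ≡ partner (σ-M m)
    σ-partner at-0  = trans σ-1 (sym (partner-subst σ-0 at-x))
    σ-partner at-1  = trans σ-0 (sym (partner-subst σ-1 at-x′))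
    σ-partner at-x  = trans σ-x′ (sym (partner-subst σ-x at-0))
    σ-partner at-x′ = trans σ-x (sym (partner-subst σ-x′ at-1))

    σ-fix : ∀ {a} → ¬ M a → σʳ a ≡ a
    σ-fix {a} a∉M = trans (cong (PC.transpose (suc zero) x′) (transpose-k zero x a (a∉M ∘ at0) (a∉M ∘ atx)))
                          (transpose-k (suc zero) x′ a (a∉M ∘ at1) (a∉M ∘ atx′))
      where
      at0 : a ≡ zero → M a
      at0 refl = at-0
      at1 : a ≡ suc zero → M a
      at1 refl = at-1
      atx : a ≡ x → M a
      atx refl = at-x
      atx′ : a ≡ x′ → M a
      atx′ refl = at-x′

    open MatchingAutomorphism X σ M M? partner partner-only partner-adj σ-M σ-partner σ-fix public

  to-front : ∀ x x′ → A x x′ ≡ true → (∀ z → A x z ≡ true → z ≡ x′) → (∀ z → A x′ z ≡ true → z ≡ x) →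
    Σ (X ≅ X) λ (α , _) → Inverse.to α x ≡ zero × Inverse.to α x′ ≡ suc zero
  to-front zero x′ axx′ _ _ = ≅-refl X , refl , adj-0 x′ axx′
  to-front (suc zero) x′ axx′ _ _ rewrite adj-1 x′ axx′ =
    twin-automorphism X zero (suc zero) twins , transpose-j zero (suc zero) , transpose-i zero (suc zero)
    where
    twins : ∀ z → z ≢ zero → z ≢ suc zero → A zero z ≡ A (suc zero) z
    twins zero          z≢0 _   = ⊥-elim (z≢0 refl)
    twins (suc zero)    _   z≢1 = ⊥-elim (z≢1 refl)
    twins (suc (suc z)) _   _   = refl
  to-front x@(suc (suc y)) x′ axx′ x-only x′-only = E.automorphism , E.σ-x , E.σ-x′
    where
    x′≢0 : x′ ≢ zero
    x′≢0 refl with () ← adj-0 x (trans (adj-sym X zero x) axx′)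
    x′≢1 : x′ ≢ suc zero
    x′≢1 refl with () ← adj-1 x (trans (adj-sym X (suc zero) x) axx′)
    module E = Exchange x x′ axx′ x-only x′-only (λ ()) (λ ()) x′≢0 x′≢1

restrict₀ : ∀ {a b} (A : Fin (suc a) → Fin (suc a) → Bool) (B : Fin (suc b) → Fin (suc b) → Bool)
  (g : Permutation (suc a) (suc b)) → g ⟨$⟩ʳ zero ≡ zero → (∀ u v → B (g ⟨$⟩ʳ u) (g ⟨$⟩ʳ v) ≡ A u v) →
  (∀ x → g ⟨$⟩ʳ suc x ≡ suc (remove zero g ⟨$⟩ʳ x)) ×
  (∀ x y → B (suc (remove zero g ⟨$⟩ʳ x)) (suc (remove zero g ⟨$⟩ʳ y)) ≡ A (suc x) (suc y))
restrict₀ A B g g0 pres = shift , λ x y → trans (cong₂ B (sym (shift x)) (sym (shift y))) (pres (suc x) (suc y))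
  where
  shift : ∀ x → g ⟨$⟩ʳ suc x ≡ suc (remove zero g ⟨$⟩ʳ x)
  shift x = trans (punchIn-permute g zero x) (cong (λ z → punchIn z (remove zero g ⟨$⟩ʳ x)) g0)

-- K₁ ∪̇ H ≅ K₁ ∪̇ G implies H ≅ G: first move the image of the isolated
-- vertex 0 back to 0 by a twin automorphism, then restrict.
cancel-K₁ : ∀ H G → (K₁ ⊕ H) ≅ (K₁ ⊕ G) → H ≅ G
cancel-K₁ H G f = remove zero (proj₁ g) , proj₂ (restrict₀ (adj (K₁ ⊕ H)) (adj X) (proj₁ g) g0 (proj₂ g))
  where
  X = K₁ ⊕ G
  w = Inverse.to (proj₁ f) zero
  isolated : ∀ {Y : Graph} z → adj (K₁ ⊕ Y) zero z ≡ false
  isolated zero    = refl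
  isolated (suc z) = refl
  w-isolated : ∀ z → adj X w z ≡ false
  w-isolated z = trans (≅-adj {K₁ ⊕ H} {X} f zero z) (isolated {H} (Inverse.from (proj₁ f) z))
  g : (K₁ ⊕ H) ≅ X
  g = ≅-trans {K₁ ⊕ H} {X} {X} f (twin-automorphism X zero w (λ z _ _ → trans (isolated {G} z) (sym (w-isolated z))))
  g0 : proj₁ g ⟨$⟩ʳ zero ≡ zero
  g0 = transpose-j zero w

-- K₂ ∪̇ H ≅ K₂ ∪̇ G implies H ≅ G: move the image of the first K₂ back to
-- the front, then restrict twice.
cancel-K₂ : ∀ H G → (K₂ ⊕ H) ≅ (K₂ ⊕ G) → H ≅ G
cancel-K₂ H G f = remove zero r , proj₂ (restrict₀ (λ x y → adj Y (suc x) (suc y)) (λ x y → adj X (suc x) (suc y)) r r0 (proj₂ first-restriction))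
  where
  X = K₂ ⊕ G
  Y = K₂ ⊕ H
  fʳ = Inverse.to (proj₁ f)
  fˡ = Inverse.from (proj₁ f)
  only-0 : ∀ z → adj Y zero z ≡ true → z ≡ suc zero
  only-0 zero          ()
  only-0 (suc zero)    _ = refl
  only-0 (suc (suc z)) ()
  only-1 : ∀ z → adj Y (suc zero) z ≡ true → z ≡ zero
  only-1 zero          _ = refl
  only-1 (suc zero)    ()
  only-1 (suc (suc z)) ()
  moved : ∀ {u v} → (∀ z → adj Y u z ≡ true → z ≡ v) → ∀ z → adj X (fʳ u) z ≡ true → z ≡ fʳ v
  moved {u} h z e = trans (sym (inverseʳ (proj₁ f))) (cong fʳ (h (fˡ z) (trans (sym (≅-adj {Y} {X} f u z)) e)))
  front = K₂-to-front.to-front G (fʳ zero) (fʳ (suc zero)) (proj₂ f zero (suc zero)) (moved only-0) (moved only-1)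
  g : Y ≅ X
  g = ≅-trans {Y} {X} {X} f (proj₁ front)
  first-restriction = restrict₀ (adj Y) (adj X) (proj₁ g) (proj₁ (proj₂ front)) (proj₂ g)
  r = remove zero (proj₁ g)
  r0 : r ⟨$⟩ʳ zero ≡ zero
  r0 = Finₚ.suc-injective (trans (sym (proj₁ first-restriction zero)) (proj₂ (proj₂ front)))

-- Number of edges, counted twice (the degree sum).
edges : Graph → ℕ
edges G = sum (λ u → countFin (adj G u))

sum-split : ∀ a {b} (f : Fin (a + b) → ℕ) → sum f ≡ sum (λ x → f (x ↑ˡ b)) + sum (λ y → f (a ↑ʳ y))
sum-split zero    f = refl
sum-split (suc a) f = trans (cong (f zero +_) (sum-split a (f ∘ suc))) (sym (+-assoc (f zero) _ _))

edges-≅ : ∀ H G → H ≅ G → edges H ≡ edges G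
edges-≅ H G (π , pres) = sym (trans (sum-permute (λ u → countFin (adj G u)) π)
  (sum-cong-≗ (λ x → trans (countFin-permute π (adj G (π ⟨$⟩ʳ x))) (countFin-cong (pres x)))))

edges-⊕ : ∀ G Y → edges (G ⊕ Y) ≡ edges G + edges Y
edges-⊕ G Y = trans (sum-split (n G) _) (cong₂ _+_
  (sum-cong-≗ (λ x → trans (countFin-onLeft (n G) _ (U.adj-lr x)) (countFin-cong (U.adj-ll x))))
  (sum-cong-≗ (λ y → trans (countFin-onRight (n G) _ (λ x → U.adj-rl y x)) (countFin-cong (U.adj-rr y)))))
  where
  module U = Union (adj G) (adj Y)

kAdj-≢ : ∀ {k} {u v : Fin k} → u ≢ v → kAdj u v ≡ true
kAdj-≢ {u = u} {v} u≢v with u ≟ v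
... | yes u≡v = ⊥-elim (u≢v u≡v)
... | no _    = refl

PD-K : ∀ k (h : 1 ≤ k) t → PD (K k h) t ≡ anyFin (lookup t)
PD-K k h t = [ nonempty-case , empty-case ]′ (true-or-false (anyFin S))
  where
  S = lookup t
  covered : ∀ u → S u ≡ true → ∀ x → domStep kAdj S x ≡ true
  covered u su x with ≡-or-≢ x u
  ... | inj₁ refl = Observation.self-dominated (K k h) S x su
  ... | inj₂ x≢u  = Observation.dominated (K k h) S x u (kAdj-≢ x≢u) su
  nonempty-case : anyFin S ≡ true → PD (K k h) t ≡ anyFin S
  nonempty-case ne = let u , su = anyFin-elim S ne in
    trans (Observation.one-round (K k h) S (λ x → inj₁ (covered u su x))) (sym ne)
  empty-case : anyFin S ≡ false → PD (K k h) t ≡ anyFin S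
  empty-case e = trans (Observation.empty-not-PD (K k h) S (anyFin-none⁻ S e)) (sym e)

module MissingEdge (k′ : ℕ) where

  k : ℕ
  k = suc (suc (suc k′))

  minusAdj : Fin k → Fin k → Bool
  minusAdj zero       (suc zero) = false
  minusAdj (suc zero) zero       = false
  minusAdj u          v          = kAdj u v

  Kₖ = K k (s≤s z≤n)

  minusAdj-sym : ∀ u v → minusAdj u v ≡ minusAdj v u
  minusAdj-sym zero                zero                = refl
  minusAdj-sym zero                (suc zero)          = refl
  minusAdj-sym zero                (suc (suc v))       = refl
  minusAdj-sym (suc zero)          zero                = refl
  minusAdj-sym (suc zero)          (suc zero)          = refl
  minusAdj-sym (suc zero)          (suc (suc v))       = refl
  minusAdj-sym (suc (suc u))       zero                = refl
  minusAdj-sym (suc (suc u))       (suc zero)          = refl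
  minusAdj-sym (suc (suc u))       (suc (suc v))       = adj-sym Kₖ (suc (suc u)) (suc (suc v))

  minusAdj-irrefl : ∀ v → minusAdj v v ≡ false
  minusAdj-irrefl zero          = refl
  minusAdj-irrefl (suc zero)    = refl
  minusAdj-irrefl (suc (suc v)) = irrefl Kₖ (suc (suc v))

  K⁻ : Graph
  K⁻ = record { n = k ; nonempty = s≤s z≤n ; adj = minusAdj ; sym = minusAdj-sym ; irrefl = minusAdj-irrefl }

  edges-K : edges Kₖ ≡ 2 + edges K⁻
  edges-K = cong suc (+-suc (countFin (minusAdj zero)) _)

  non-edge : ∀ x u → minusAdj x u ≡ false → x ≢ u → (x ≡ zero × u ≡ suc zero) ⊎ (x ≡ suc zero × u ≡ zero)
  non-edge zero          zero          _ x≢u = ⊥-elim (x≢u refl)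
  non-edge zero          (suc zero)    _ _   = inj₁ (refl , refl)
  non-edge (suc zero)    zero          _ _   = inj₂ (refl , refl)
  non-edge (suc zero)    (suc zero)    _ x≢u = ⊥-elim (x≢u refl)
  non-edge (suc (suc x)) (suc (suc u)) e x≢u with () ← trans (sym (kAdj-≢ x≢u)) e

  -- The vertex 2 is adjacent to both 0 and 1 and forces one from the other.
  forced-by-2 : ∀ S x u → S u ≡ true → (x ≡ zero × u ≡ suc zero) ⊎ (x ≡ suc zero × u ≡ zero) →
    ∃ λ y → Observation.Forces K⁻ (domStep minusAdj S) y x
  forced-by-2 S x u su (inj₁ (refl , refl)) = two , Observation.dominated K⁻ S two u refl su , refl , only
    where
    two = suc (suc zero)
    only : ∀ z → minusAdj two z ≡ true → domStep minusAdj S z ≡ false → z ≡ zero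
    only zero          _ _ = refl
    only (suc zero)    _ c with () ← trans (sym (Observation.self-dominated K⁻ S (suc zero) su)) c
    only (suc (suc z)) _ c with () ← trans (sym (Observation.dominated K⁻ S (suc (suc z)) (suc zero) refl su)) c
  forced-by-2 S x u su (inj₂ (refl , refl)) = two , Observation.dominated K⁻ S two u refl su , refl , only
    where
    two = suc (suc zero)
    only : ∀ z → minusAdj two z ≡ true → domStep minusAdj S z ≡ false → z ≡ suc zero
    only zero          _ c with () ← trans (sym (Observation.self-dominated K⁻ S zero su)) c
    only (suc zero)    _ _ = refl
    only (suc (suc z)) _ c with () ← trans (sym (Observation.dominated K⁻ S (suc (suc z)) zero refl su)) c

  covered : ∀ S u → S u ≡ true → ∀ x → domStep minusAdj S x ≡ true ⊎ ∃ λ y → Observation.Forces K⁻ (domStep minusAdj S) y x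
  covered S u su x with ≡-or-≢ x u | true-or-false (minusAdj x u)
  ... | inj₁ refl | _      = inj₁ (Observation.self-dominated K⁻ S x su)
  ... | inj₂ _    | inj₁ e = inj₁ (Observation.dominated K⁻ S x u e su)
  ... | inj₂ x≢u  | inj₂ e = inj₂ (forced-by-2 S x u su (non-edge x u e x≢u))

  PD-K⁻ : ∀ t → PD K⁻ t ≡ anyFin (lookup t)
  PD-K⁻ t = [ nonempty-case , empty-case ]′ (true-or-false (anyFin S))
    where
    S = lookup t
    nonempty-case : anyFin S ≡ true → PD K⁻ t ≡ anyFin S
    nonempty-case ne = let u , su = anyFin-elim S ne in trans (Observation.one-round K⁻ S (covered S u su)) (sym ne)
    empty-case : anyFin S ≡ false → PD K⁻ t ≡ anyFin S
    empty-case e = trans (Observation.empty-not-PD K⁻ S (anyFin-none⁻ S e)) (sym e)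

  -- Hence G ∪̇ (Kₖ minus an edge) has the polynomial of G ∪̇ Kₖ, but fewer edges.
  same-polynomial : ∀ G (h : 1 ≤ k) → SamePolynomial (G ⊕ K⁻) (G ⊕ K k h)
  same-polynomial G h i = begin
    p (G ⊕ K⁻) i         ≡⟨ p-⊕ G K⁻ i ⟩
    double-sum (PD K⁻)    ≡⟨ sumSubsets-cong (n G) (λ s → sumSubsets-cong k {λ t → term s (PD K⁻ t) t} {λ t → term s (PD Kₖ′ t) t}
                               (λ t → cong (λ b → term s b t) (same-PD t))) ⟩
    double-sum (PD Kₖ′)   ≡⟨ p-⊕ G Kₖ′ i ⟨
    p (G ⊕ Kₖ′) i        ∎
    where
    open ≡-Reasoning
    Kₖ′ = K k h
    term : Vec Bool (n G) → Bool → Vec Bool k → ℕ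
    term s b t = χ ((PD G s ∧ b) ∧ does (card s + card t ℕ.≟ i))
    double-sum : (Vec Bool k → Bool) → ℕ
    double-sum pd = sumSubsets (n G) (λ s → sumSubsets k (λ t → term s (pd t) t))
    same-PD : ∀ t → PD K⁻ t ≡ PD Kₖ′ t
    same-PD t = trans (PD-K⁻ t) (sym (PD-K k h t))

  not-isomorphic : ∀ G (h : 1 ≤ k) → ¬ (G ⊕ K⁻) ≅ (G ⊕ K k h)
  not-isomorphic G h iso = m≢2+m (+-cancelˡ-≡ (edges G) _ _ (begin
    edges G + edges K⁻          ≡⟨ edges-⊕ G K⁻ ⟨
    edges (G ⊕ K⁻)              ≡⟨ edges-≅ (G ⊕ K⁻) (G ⊕ K k h) iso ⟩
    edges (G ⊕ K k h)           ≡⟨ edges-⊕ G (K k h) ⟩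
    edges G + edges (K k h)     ≡⟨ cong (edges G +_) edges-K ⟩
    edges G + (2 + edges K⁻)    ∎))
    where
    open ≡-Reasoning
    m≢2+m : ∀ {m} → m ≢ 2 + m
    m≢2+m {suc m} e = m≢2+m (suc-injective e)

record Cancellable (F : Graph) : Set where
  field
    same-⊕   : ∀ X Y → SamePolynomial X Y → SamePolynomial (F ⊕ X) (F ⊕ Y)
    cancel-⊕ : ∀ X Y → SamePolynomial (F ⊕ X) (F ⊕ Y) → SamePolynomial X Y
    cancel-≅ : ∀ X Y → (F ⊕ X) ≅ (F ⊕ Y) → X ≅ Y
    split    : ∀ H G → SamePolynomial H (F ⊕ G) → ∃ λ H′ → (F ⊕ H′) ≅ H

unique⇔unique-⊕ : ∀ {F} → Cancellable F → ∀ G → PUnique G ⇔ PUnique (G ⊕ F)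
unique⇔unique-⊕ {F} c G = mk⇔ preserve reflect
  where
  open Cancellable c
  flip-⊕ : ∀ X → SamePolynomial (X ⊕ F) (F ⊕ X)
  flip-⊕ X = ≅⇒same (X ⊕ F) (F ⊕ X) (⊕-comm X F)
  -- H has the polynomial of F ∪̇ G, so H ≅ F ∪̇ H′ where H′ has the
  -- polynomial of G, hence H′ ≅ G.
  preserve : PUnique G → PUnique (G ⊕ F)
  preserve unique H e = ≅-trans {H} {F ⊕ H′} {G ⊕ F} (≅-sym {F ⊕ H′} {H} iso)
    (≅-trans {F ⊕ H′} {F ⊕ G} {G ⊕ F} (⊕-cong {F} {F} {H′} {G} (≅-refl F) (unique H′ same)) (⊕-comm F G))
    where
    e′ : SamePolynomial H (F ⊕ G)
    e′ i = trans (e i) (flip-⊕ G i)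
    H′ = proj₁ (split H G e′)
    iso = proj₂ (split H G e′)
    same : SamePolynomial H′ G
    same = cancel-⊕ H′ G (λ i → trans (≅⇒same (F ⊕ H′) H iso i) (e′ i))
  -- H has the polynomial of G, so H ∪̇ F ≅ G ∪̇ F, and F cancels.
  reflect : PUnique (G ⊕ F) → PUnique G
  reflect unique H e = cancel-≅ H G (≅-trans {F ⊕ H} {H ⊕ F} {F ⊕ G} (⊕-comm F H)
    (≅-trans {H ⊕ F} {G ⊕ F} {F ⊕ G} (unique (H ⊕ F) same) (⊕-comm G F)))
    where
    same : SamePolynomial (H ⊕ F) (G ⊕ F)
    same i = trans (flip-⊕ H i) (trans (same-⊕ H G e i) (sym (flip-⊕ G i)))

-- K₁ and K₂ are cancellable: an isolated vertex, resp. a K₂ component,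
-- is detected by the polynomial and splits off.
K₁-cancellable : Cancellable K₁
K₁-cancellable = record
  { same-⊕   = same-K₁⊕
  ; cancel-⊕ = cancel-K₁⊕
  ; cancel-≅ = cancel-K₁
  ; split    = λ H G e → let v , isolated = has-isolated H G e in
      split-K₁ H v isolated (subst (2 ≤_) (sym (same-order H (K₁ ⊕ G) e)) (s≤s (nonempty G)))
  }

K₂-cancellable : Cancellable K₂
K₂-cancellable = record
  { same-⊕   = same-K₂⊕
  ; cancel-⊕ = cancel-K₂⊕
  ; cancel-≅ = cancel-K₂
  ; split    = λ H G e → let u , v , component = has-K₂ H G e in
      split-K₂ H u v component (subst (3 ≤_) (sym (same-order H (K₂ ⊕ G) e)) (s≤s (s≤s (nonempty G))))
  }

-- G ∪̇ Kₖ has the polynomial of the non-isomorphic G ∪̇ (Kₖ minus an edge).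
not-unique-⊕-K : ∀ G k (h : 3 ≤ k) (h₁ : 1 ≤ k) → ¬ PUnique (G ⊕ K k h₁)
not-unique-⊕-K G .(suc (suc (suc k′))) (s≤s (s≤s (s≤s {n = k′} z≤n))) h₁ unique =
  not-isomorphic G h₁ (unique (G ⊕ K⁻) (same-polynomial G h₁))
  where open MissingEdge k′

theorem24 : (G : Graph) →
    (PUnique G ⇔ PUnique (G ⊕ K 1 (s≤s z≤n))) ×
    (PUnique G ⇔ PUnique (G ⊕ K 2 (s≤s z≤n))) ×
    (∀ (k : ℕ) (h : 3 ≤ k) → ¬ PUnique (G ⊕ K k (≤-trans (s≤s z≤n) h)))
theorem24 G =
  unique⇔unique-⊕ K₁-cancellable G ,
  unique⇔unique-⊕ K₂-cancellable G ,
  λ k h → not-unique-⊕-K G k h (≤-trans (s≤s z≤n) h)
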